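{- For every $n\ge 1$ and every integer $h$ with $0\le h\le n-1$, the number of modified ascent sequences of length $n$ that avoid the pattern $2321$ and have exactly $h$ ascents is equal to the Stirling number of the second kind $S(n,n-h)$.
   Context: A Cayley permutation of length $n$ is a word $x=x_1\cdots x_n$ of positive integers whose set of values is $\{1,\dots,k\}$ for some $k\le n$. A Cayley permutation $x$ contains a Cayley permutation $y=y_1\cdots y_k$ if there are indices $i_1<\cdots<i_k$ with $x_{i_s}<x_{i_t}\iff y_s<y_t$ and $x_{i_s}=x_{i_t}\iff y_s=y_t$ for all $s,t$; otherwise $x$ avoids $y$. The ascent tops of $x$ are the pairs $(1,x_1)$ and $(i,x_i)$ with $1<i\le n$ and $x_{i-1}<x_i$. The leftmost copies of $x$ are the pairs $(\min\{i: x_i=j\},j)$ for $1\le j\le \max(x)$. A modified ascent sequence is a Cayley permutation whose set of ascent tops equals its set of leftmost copies. An ascent of $x$ is an index $i\in\{1,\dots,n-1\}$ with $x_i<x_{i+1}$. $S(n,k)$ denotes the number of partitions of an $n$-element set into $k$ blocks. -}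

module Defs where

open import Data.Bool using (Bool; true; false; _∧_; _∨_; not; if_then_else_)
open import Data.Nat using (ℕ; zero; suc; _+_; _*_; _⊔_)
open import Data.Nat.Base using (_≡ᵇ_; _<ᵇ_; _≤ᵇ_)
open import Data.List using (List; []; _∷_; map; concatMap; applyUpTo; zip; length; filterᵇ; _++_; foldr)
open import Data.Product using (_×_; _,_)
open import Data.Bool.ListAction using (all; any)

-- Words are lists of natural numbers; positions and values are 1-based.

range1 : ℕ → List ℕ
range1 m = applyUpTo suc m

maxL : List ℕ → ℕ
maxL = foldr _⊔_ 0

isCayley : List ℕ → Bool
isCayley x = all (λ v → 1 ≤ᵇ v) x ∧ all (λ j → any (λ v → j ≡ᵇ v) x) (range1 (maxL x))

words : ℕ → ℕ → List (List ℕ)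
words zero    m = [] ∷ []
words (suc n) m = concatMap (λ v → map (v ∷_) (words n m)) (range1 m)

subseqs : List ℕ → List (List ℕ)
subseqs []       = [] ∷ []
subseqs (a ∷ as) = map (a ∷_) (subseqs as) ++ subseqs as

_==ᵇ_ : Bool → Bool → Bool
true  ==ᵇ b = b
false ==ᵇ b = not b

sameOrder : ℕ → ℕ → ℕ → ℕ → Bool
sameOrder a a' b b' =
  ((a <ᵇ a') ==ᵇ (b <ᵇ b')) ∧ ((a' <ᵇ a) ==ᵇ (b' <ᵇ b)) ∧ ((a ≡ᵇ a') ==ᵇ (b ≡ᵇ b'))

orderIso : List ℕ → List ℕ → Bool
orderIso []       []       = true
orderIso []       (_ ∷ _)  = false
orderIso (_ ∷ _)  []       = false
orderIso (a ∷ as) (b ∷ bs) =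
  all (λ p → sameOrder a (Data.Product.proj₁ p) b (Data.Product.proj₂ p)) (zip as bs)
  ∧ orderIso as bs

contains : List ℕ → List ℕ → Bool
contains x y = any (λ s → orderIso s y) (subseqs x)

avoids : List ℕ → List ℕ → Bool
avoids x y = not (contains x y)

_==ₚ_ : ℕ × ℕ → ℕ × ℕ → Bool
(a , b) ==ₚ (c , d) = (a ≡ᵇ c) ∧ (b ≡ᵇ d)

memₚ : ℕ × ℕ → List (ℕ × ℕ) → Bool
memₚ p ps = any (λ q → p ==ₚ q) ps

sameSetₚ : List (ℕ × ℕ) → List (ℕ × ℕ) → Bool
sameSetₚ ps qs = all (λ p → memₚ p qs) ps ∧ all (λ q → memₚ q ps) qs

-- ascent tops (i, x_i) for i ≥ 2 with x_{i-1} < x_i; argument: index of b, previous letter, rest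
ascTopsFrom : ℕ → ℕ → List ℕ → List (ℕ × ℕ)
ascTopsFrom i prev []       = []
ascTopsFrom i prev (b ∷ bs) =
  if prev <ᵇ b then (i , b) ∷ ascTopsFrom (suc i) b bs else ascTopsFrom (suc i) b bs

ascTops : List ℕ → List (ℕ × ℕ)
ascTops []       = []
ascTops (a ∷ as) = (1 , a) ∷ ascTopsFrom 2 a as

firstPosFrom : ℕ → ℕ → List ℕ → ℕ
firstPosFrom i j []       = i
firstPosFrom i j (v ∷ vs) = if j ≡ᵇ v then i else firstPosFrom (suc i) j vs

leftmostCopies : List ℕ → List (ℕ × ℕ)
leftmostCopies x = map (λ j → (firstPosFrom 1 j x , j)) (range1 (maxL x))

isModAscent : List ℕ → Bool
isModAscent x = isCayley x ∧ sameSetₚ (ascTops x) (leftmostCopies x)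

ascents : List ℕ → ℕ
ascents []           = 0
ascents (a ∷ [])     = 0
ascents (a ∷ b ∷ bs) = (if a <ᵇ b then 1 else 0) + ascents (b ∷ bs)

-- Cayley permutations of length n all lie in {1..n}^n, so this lists exactly the
-- modified ascent sequences of length n (each once)
modAscSeqs : ℕ → List (List ℕ)
modAscSeqs n = filterᵇ isModAscent (words n n)

pattern2321 : List ℕ
pattern2321 = 2 ∷ 3 ∷ 2 ∷ 1 ∷ []

countMAS : ℕ → ℕ → ℕ
countMAS n h = length (filterᵇ (λ x → avoids x pattern2321 ∧ (ascents x ≡ᵇ h)) (modAscSeqs n))

S : ℕ → ℕ → ℕ
S zero    zero    = 1
S zero    (suc k) = 0
S (suc n) zero    = 0
S (suc n) (suc k) = suc k * S n (suc k) + S n k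

{-# OPTIONS --safe #-}
module Submission where

-- A Cayley permutation is a 2321-avoiding modified ascent sequence iff, read from left to
-- right, every letter occurs for the first time exactly when it is an ascent top, and no
-- letter is smaller than the bottom of the latest strict descent before it.  Every such word
-- of length n + 1 arises exactly once from such a word x of length n and a mark of x:
-- mark 0 duplicates the first copy of the maximum, and each of the n − asc(x) positions
-- followed by a weak descent or by the end inserts a new maximum M, turning A v vs B₁ B₂
-- into A B₁ M v vs B₂, where v vs is the plateau after the mark and B₁ ends at the last
-- later letter below v.  Mark 0 keeps the number of ascents and the others add one, so
-- the counts a(n, h) satisfy a(n + 1, h) = a(n, h) + (n − h + 1) a(n, h − 1), the
-- recurrence of S(n + 1, n + 1 − h).

open import Defs

open import Algebra.Properties.CommutativeSemigroup using (interchange)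
open import Data.Bool using (Bool; T; true; false; _∧_; if_then_else_; not)
open import Data.Bool.Properties using (T-∧; ∧-assoc)
open import Data.Bool.ListAction using (all; any)
open import Data.Empty using (⊥-elim)
open import Data.List
  using (List; []; _∷_; _++_; [_]; map; concatMap; length; foldl; reverseAcc; take; drop; filterᵇ; head;
         takeWhile; dropWhile; cartesianProductWith)
open import Data.List.Properties
  using (++-assoc; ++-identityʳ; length-++; length-map; foldl-++; ∷-injective; takeWhile++dropWhile;
         take-all; drop-all; filter-++)
open import Data.List.Membership.Propositional using (_∈_; _∉_; find)
open import Data.List.Membership.Propositional.Properties
  using (∈-++⁺ˡ; ∈-++⁺ʳ; ∈-++⁻; ∈-map⁺; ∈-map⁻; ∈-∃++; ∈-applyUpTo⁺; ∈-applyUpTo⁻; ∈-filter⁺; ∈-filter⁻;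
         ∈-concatMap⁺; ∈-concatMap⁻)
open import Data.List.Membership.Propositional.Properties.WithK using (unique∧set⇒bag)
open import Data.List.Relation.Binary.BagAndSetEquality using (_∼[_]_; set; ∼bag⇒↭)
open import Data.List.Relation.Binary.Permutation.Propositional using (_↭_; prep; ↭-sym; ↭-trans; ↭-reflexive)
open import Data.List.Relation.Binary.Permutation.Propositional.Properties
  using (shift; shifts; ++⁺ˡ; ∈-resp-↭; ↭-length; ∷↭∷ʳ)
open import Data.List.Relation.Binary.Sublist.Propositional
  using ([]; _∷_; _∷ʳ_; from∈; minimum) renaming (_⊆_ to _⊑_)
import Data.List.Relation.Binary.Sublist.Propositional.Properties as Sublist
open import Data.List.Relation.Binary.Subset.Propositional using (_⊆_)
open import Data.List.Relation.Unary.All as All using (All; []; _∷_; lookup; tabulate)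
import Data.List.Relation.Unary.All.Properties as All
open import Data.List.Relation.Unary.All.Properties using (all-takeWhile; all-head-dropWhile)
open import Data.List.Relation.Unary.AllPairs using ([]; _∷_)
open import Data.List.Relation.Unary.Any as Any using (Any; here; there)
import Data.List.Relation.Unary.Any.Properties as Any
open import Data.List.Relation.Unary.Unique.Propositional using (Unique)
import Data.List.Relation.Unary.Unique.Propositional.Properties as Unique
open import Data.Maybe.Relation.Unary.All as Maybe using (just; nothing)
open import Data.Nat using (ℕ; zero; suc; _+_; _*_; _∸_; _≤_; _<_; _<ᵇ_; _≡ᵇ_; z≤n; s≤s; s≤s⁻¹)
open import Data.Nat.ListAction using (sum)
open import Data.Nat.Properties
open import Data.List.Membership.DecPropositional _≟_ using (_∈?_)
open import Data.Product using (_×_; _,_; proj₁; proj₂; ∃-syntax)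
open import Data.Product.Properties using (,-injective)
open import Data.Sum using (_⊎_; inj₁; inj₂)
open import Data.Unit using (⊤; tt)
open import Function using (_∘_; _⇔_; mk⇔; Equivalence)
open import Relation.Binary.Definitions using () renaming (Decidable to Decidable₂)
open import Relation.Binary.PropositionalEquality
  using (_≡_; _≢_; refl; sym; trans; cong; cong₂; subst; ≢-sym; module ≡-Reasoning)
open import Relation.Nullary using (¬_; yes; no; does; ¬?)
open import Relation.Nullary.Decidable using (dec-true; dec-false)
open import Relation.Nullary.Reflects using (Reflects; ofʸ; ofⁿ; fromEquivalence; det)
open import Relation.Unary using (Decidable; ∁)

≡ᵇ-reflects-≡ : ∀ m n → Reflects (m ≡ n) (m ≡ᵇ n)
≡ᵇ-reflects-≡ m n = fromEquivalence (≡ᵇ⇒≡ m n) (≡⇒≡ᵇ m n)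

<ᵇ-true : ∀ {m n} → m < n → (m <ᵇ n) ≡ true
<ᵇ-true {m} {n} m<n = det (<ᵇ-reflects-< m n) (ofʸ m<n)

<ᵇ-false : ∀ {m n} → n ≤ m → (m <ᵇ n) ≡ false
<ᵇ-false {m} {n} n≤m = det (<ᵇ-reflects-< m n) (ofⁿ (≤⇒≯ n≤m))

≡ᵇ-refl : ∀ m → (m ≡ᵇ m) ≡ true
≡ᵇ-refl m = det (≡ᵇ-reflects-≡ m m) (ofʸ refl)

≡ᵇ-false : ∀ {m n} → m ≢ n → (m ≡ᵇ n) ≡ false
≡ᵇ-false {m} {n} m≢n = det (≡ᵇ-reflects-≡ m n) (ofⁿ m≢n)

∈⇔any-≡ᵇ : ∀ {j} xs → j ∈ xs ⇔ T (any (j ≡ᵇ_) xs)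
∈⇔any-≡ᵇ {j} xs = mk⇔ (Any.any⁺ _ ∘ Any.map (≡⇒≡ᵇ j _)) (Any.map (≡ᵇ⇒≡ j _) ∘ Any.any⁻ _ xs)

-- Reading a word from left to right

lastOr : ℕ → List ℕ → ℕ
lastOr = foldl (λ _ v → v)

lastOr-++ : ∀ p u w → lastOr p (u ++ w) ≡ lastOr (lastOr p u) w
lastOr-++ = foldl-++ _

lastOr-∷ʳ : ∀ p u v → lastOr p (u ++ [ v ]) ≡ v
lastOr-∷ʳ p u v = lastOr-++ p u [ v ]

lastOr-∈ : ∀ p (u : List ℕ) → u ≢ [] → lastOr p u ∈ u
lastOr-∈ p []          u≢[] = ⊥-elim (u≢[] refl)
lastOr-∈ p (v ∷ [])    _    = here refl
lastOr-∈ p (v ∷ w ∷ u) _    = there (lastOr-∈ v (w ∷ u) (λ ()))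

lastOr-All : ∀ {P : ℕ → Set} p u → P p → All P u → P (lastOr p u)
lastOr-All p []      Pp []         = Pp
lastOr-All p (v ∷ u) Pp (Pv ∷ Pu) = lastOr-All v u Pv Pu

∈-reverseAcc⁻ : ∀ {a : ℕ} (S u : List ℕ) → a ∈ reverseAcc S u → a ∈ S ⊎ a ∈ u
∈-reverseAcc⁻ {a} = Any.reverseAcc⁻ {P = a ≡_}

∈-reverseAccˡ : ∀ {a : ℕ} (S u : List ℕ) → a ∈ S → a ∈ reverseAcc S u
∈-reverseAccˡ {a} S u = Any.reverseAcc⁺ {P = a ≡_} S u ∘ inj₁

∈-reverseAccʳ : ∀ {a : ℕ} (S u : List ℕ) → a ∈ u → a ∈ reverseAcc S u
∈-reverseAccʳ {a} S u = Any.reverseAcc⁺ {P = a ≡_} S u ∘ inj₂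

∈-reverseAcc[] : ∀ {a : ℕ} u → a ∈ reverseAcc [] u → a ∈ u
∈-reverseAcc[] u a∈ with ∈-reverseAcc⁻ [] u a∈
... | inj₂ a∈u = a∈u

-- NewAtTops S p w: continuing a prefix whose letters are S and whose last letter is p
-- (p = 0 for the empty prefix), each letter of w occurs for the first time exactly
-- when it is an ascent top.
data NewAtTops : List ℕ → ℕ → List ℕ → Set where
  []  : ∀ {S p} → NewAtTops S p []
  new : ∀ {S p v w} → v ∉ S → p < v → NewAtTops (v ∷ S) v w → NewAtTops S p (v ∷ w)
  old : ∀ {S p v w} → v ∈ S → v ≤ p → NewAtTops (v ∷ S) v w → NewAtTops S p (v ∷ w)

NewAtTops-tail : ∀ {S p v w} → NewAtTops S p (v ∷ w) → NewAtTops (v ∷ S) v w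
NewAtTops-tail (new _ _ n) = n
NewAtTops-tail (old _ _ n) = n

NewAtTops-++⁻ : ∀ {S p} u {w} → NewAtTops S p (u ++ w) →
                NewAtTops S p u × NewAtTops (reverseAcc S u) (lastOr p u) w
NewAtTops-++⁻ []      n              = [] , n
NewAtTops-++⁻ (v ∷ u) (new v∉ p<v n) = let nu , nw = NewAtTops-++⁻ u n in new v∉ p<v nu , nw
NewAtTops-++⁻ (v ∷ u) (old v∈ v≤p n) = let nu , nw = NewAtTops-++⁻ u n in old v∈ v≤p nu , nw

NewAtTops-++⁺ : ∀ {S p} u {w} → NewAtTops S p u → NewAtTops (reverseAcc S u) (lastOr p u) w →
                NewAtTops S p (u ++ w)
NewAtTops-++⁺ []      []              nw = nw
NewAtTops-++⁺ (v ∷ u) (new v∉ p<v nu) nw = new v∉ p<v (NewAtTops-++⁺ u nu nw)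
NewAtTops-++⁺ (v ∷ u) (old v∈ v≤p nu) nw = old v∈ v≤p (NewAtTops-++⁺ u nu nw)

SameOn : List ℕ → List ℕ → List ℕ → Set
SameOn w S S′ = ∀ {a} → a ∈ w → (a ∈ S → a ∈ S′) × (a ∈ S′ → a ∈ S)

SameOn-∷ : ∀ {v w S S′} → SameOn (v ∷ w) S S′ → SameOn w (v ∷ S) (v ∷ S′)
SameOn-∷ same a∈w =
  (λ { (here e) → here e ; (there a∈S) → there (proj₁ (same (there a∈w)) a∈S) }) ,
  (λ { (here e) → here e ; (there a∈S′) → there (proj₂ (same (there a∈w)) a∈S′) })

NewAtTops-resp : ∀ {S S′ p w} → SameOn w S S′ → NewAtTops S p w → NewAtTops S′ p w
NewAtTops-resp same []             = []
NewAtTops-resp same (new v∉ p<v n) = new (v∉ ∘ proj₂ (same (here refl))) p<v (NewAtTops-resp (SameOn-∷ same) n)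
NewAtTops-resp same (old v∈ v≤p n) = old (proj₁ (same (here refl)) v∈) v≤p (NewAtTops-resp (SameOn-∷ same) n)

NewAtTops-absorb : ∀ {S p v w} → v ∈ S → NewAtTops (v ∷ S) p w → NewAtTops S p w
NewAtTops-absorb v∈S = NewAtTops-resp (λ _ → (λ { (here refl) → v∈S ; (there a∈S) → a∈S }) , there)

NewAtTops-repeat : ∀ {S p v w} → v ∈ S → NewAtTops S p w → NewAtTops (v ∷ S) p w
NewAtTops-repeat v∈S = NewAtTops-resp (λ _ → there , (λ { (here refl) → v∈S ; (there a∈S) → a∈S }))

-- AboveFloor p d w: continuing a prefix with last letter p whose latest strict descent
-- ends at d, no letter of w is smaller than the bottom of the latest strict descent
-- before it.  The rule up needs no check d ≤ v because d ≤ p is invariant.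
data AboveFloor : ℕ → ℕ → List ℕ → Set where
  []   : ∀ {p d} → AboveFloor p d []
  up   : ∀ {p d v w} → p ≤ v → AboveFloor v d w → AboveFloor p d (v ∷ w)
  down : ∀ {p d v w} → v < p → d ≤ v → AboveFloor v v w → AboveFloor p d (v ∷ w)

floorAfter : ℕ → ℕ → List ℕ → ℕ
floorAfter p d []      = d
floorAfter p d (v ∷ w) = floorAfter v (if v <ᵇ p then v else d) w

floorAfter-up : ∀ {p v} d w → p ≤ v → floorAfter p d (v ∷ w) ≡ floorAfter v d w
floorAfter-up d w p≤v rewrite <ᵇ-false p≤v = refl

floorAfter-down : ∀ {p v} d w → v < p → floorAfter p d (v ∷ w) ≡ floorAfter v v w
floorAfter-down d w v<p rewrite <ᵇ-true v<p = refl

AboveFloor-tail : ∀ {p d v w} → AboveFloor p d (v ∷ w) → AboveFloor v (floorAfter p d [ v ]) w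
AboveFloor-tail (up p≤v f)       rewrite <ᵇ-false p≤v = f
AboveFloor-tail (down v<p _ f)   rewrite <ᵇ-true v<p  = f

AboveFloor-++⁻ : ∀ {p d} u {w} → AboveFloor p d (u ++ w) →
                 AboveFloor p d u × AboveFloor (lastOr p u) (floorAfter p d u) w
AboveFloor-++⁻ []      a = [] , a
AboveFloor-++⁻ {d = d} (v ∷ u) (up p≤v a) rewrite floorAfter-up d u p≤v =
  let au , aw = AboveFloor-++⁻ u a in up p≤v au , aw
AboveFloor-++⁻ {d = d} (v ∷ u) (down v<p d≤v a) rewrite floorAfter-down d u v<p =
  let au , aw = AboveFloor-++⁻ u a in down v<p d≤v au , aw

AboveFloor-++⁺ : ∀ {p d} u {w} → AboveFloor p d u → AboveFloor (lastOr p u) (floorAfter p d u) w →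
                 AboveFloor p d (u ++ w)
AboveFloor-++⁺ []      []                  aw = aw
AboveFloor-++⁺ {d = d} (v ∷ u) (up p≤v au) aw rewrite floorAfter-up d u p≤v = up p≤v (AboveFloor-++⁺ u au aw)
AboveFloor-++⁺ {d = d} (v ∷ u) (down v<p d≤v au) aw rewrite floorAfter-down d u v<p =
  down v<p d≤v (AboveFloor-++⁺ u au aw)

AboveFloor-lower : ∀ {p d w} → d ≤ p → AboveFloor p d w → All (d ≤_) w
AboveFloor-lower d≤p []               = []
AboveFloor-lower d≤p (up p≤v a)       = ≤-trans d≤p p≤v ∷ AboveFloor-lower (≤-trans d≤p p≤v) a
AboveFloor-lower d≤p (down v<p d≤v a) = d≤v ∷ All.map (≤-trans d≤v) (AboveFloor-lower ≤-refl a)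

floorAfter≤lastOr : ∀ {p d w} → d ≤ p → AboveFloor p d w → floorAfter p d w ≤ lastOr p w
floorAfter≤lastOr d≤p [] = d≤p
floorAfter≤lastOr {d = d} d≤p (up {w = w} p≤v a) rewrite floorAfter-up d w p≤v =
  floorAfter≤lastOr (≤-trans d≤p p≤v) a
floorAfter≤lastOr {d = d} d≤p (down {w = w} v<p _ a) rewrite floorAfter-down d w v<p =
  floorAfter≤lastOr ≤-refl a

AboveFloor-refloor : ∀ {p d d′ w} → All (d′ ≤_) w → AboveFloor p d w → AboveFloor p d′ w
AboveFloor-refloor _           []             = []
AboveFloor-refloor (_ ∷ d′≤w)  (up p≤v a)     = up p≤v (AboveFloor-refloor d′≤w a)
AboveFloor-refloor (d′≤v ∷ _)  (down v<p _ a) = down v<p d′≤v a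

-- A repeated letter that differs from its predecessor is a strict descent bottom.
above-repeat : ∀ {S p d a w} → a ∈ S → a ≢ p → NewAtTops S p (a ∷ w) → AboveFloor p d (a ∷ w) → All (a ≤_) w
above-repeat a∈S a≢p (new a∉S _ _) _            = ⊥-elim (a∉S a∈S)
above-repeat a∈S a≢p (old _ a≤p _) (up p≤a _)   = ⊥-elim (a≢p (≤-antisym a≤p p≤a))
above-repeat a∈S a≢p (old _ _ _)   (down _ _ f) = AboveFloor-lower ≤-refl f

above-later-repeat : ∀ {S p d a} w₁ {w₂} → a ∈ S → a ≢ p →
                     NewAtTops S p (w₁ ++ a ∷ w₂) → AboveFloor p d (w₁ ++ a ∷ w₂) → All (a ≤_) w₂
above-later-repeat []       a∈S a≢p n f = above-repeat a∈S a≢p n f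
above-later-repeat {a = a} (v ∷ w₁) a∈S a≢p n f with v ≟ a
... | yes refl = All.tail (All.++⁻ʳ w₁ (above-repeat a∈S a≢p n f))
... | no v≢a   = above-later-repeat w₁ (there a∈S) (≢-sym v≢a) (NewAtTops-tail n) (AboveFloor-tail f)

-- Decoding the definitions

∈⇒≤maxL : ∀ {v} x → v ∈ x → v ≤ maxL x
∈⇒≤maxL (a ∷ x) (here refl) = m≤m⊔n a (maxL x)
∈⇒≤maxL (a ∷ x) (there v∈x) = ≤-trans (∈⇒≤maxL x v∈x) (m≤n⊔m a (maxL x))

maxL≤ : ∀ {m} x → All (_≤ m) x → maxL x ≤ m
maxL≤ []      []          = z≤n
maxL≤ (a ∷ x) (a≤m ∷ x≤m) = ⊔-lub a≤m (maxL≤ x x≤m)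

maxL∈ : ∀ x → 0 < maxL x → maxL x ∈ x
maxL∈ (a ∷ x) 0<max with ⊔-sel a (maxL x)
... | inj₁ eq = subst (_∈ a ∷ x) (sym eq) (here refl)
... | inj₂ eq = subst (_∈ a ∷ x) (sym eq) (there (maxL∈ x (subst (0 <_) eq 0<max)))

Cayley : List ℕ → Set
Cayley x = All (1 ≤_) x × (∀ {i} → i < maxL x → suc i ∈ x)

isCayley⇔ : ∀ x → T (isCayley x) ⇔ Cayley x
isCayley⇔ x = mk⇔ to from
  where
  to : T (isCayley x) → Cayley x
  to t = let pos , onto = Equivalence.to T-∧ t in
    All.map (≤ᵇ⇒≤ 1 _) (All.all⁺ _ x pos) ,
    λ i<max → Equivalence.from (∈⇔any-≡ᵇ x) (All.applyUpTo⁻ suc (maxL x) (All.all⁺ _ _ onto) i<max)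
  from : Cayley x → T (isCayley x)
  from (pos , onto) = Equivalence.from T-∧
    (All.all⁻ _ (All.map ≤⇒≤ᵇ pos) ,
     All.all⁻ _ (All.applyUpTo⁺₁ suc (maxL x) (Equivalence.to (∈⇔any-≡ᵇ x) ∘ onto)))

SameSet : List (ℕ × ℕ) → List (ℕ × ℕ) → Set
SameSet A B = A ⊆ B × B ⊆ A

memₚ⇔∈ : ∀ q qs → T (memₚ q qs) ⇔ q ∈ qs
memₚ⇔∈ (i , j) qs = mk⇔ (Any.map ==ₚ⇒≡ ∘ Any.any⁻ _ qs) (Any.any⁺ _ ∘ Any.map ≡⇒==ₚ)
  where
  ==ₚ⇒≡ : ∀ {q} → T ((i , j) ==ₚ q) → (i , j) ≡ q
  ==ₚ⇒≡ {k , l} t = let i≡k , j≡l = Equivalence.to T-∧ t in cong₂ _,_ (≡ᵇ⇒≡ i k i≡k) (≡ᵇ⇒≡ j l j≡l)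
  ≡⇒==ₚ : ∀ {q} → (i , j) ≡ q → T ((i , j) ==ₚ q)
  ≡⇒==ₚ refl = Equivalence.from T-∧ (≡⇒≡ᵇ i i refl , ≡⇒≡ᵇ j j refl)

sameSetₚ⇔ : ∀ A B → T (sameSetₚ A B) ⇔ SameSet A B
sameSetₚ⇔ A B = mk⇔ to from
  where
  ⊆-of : ∀ C D → T (all (λ q → memₚ q D) C) → C ⊆ D
  ⊆-of C D t q∈C = Equivalence.to (memₚ⇔∈ _ D) (lookup (All.all⁺ _ C t) q∈C)
  of-⊆ : ∀ C D → C ⊆ D → T (all (λ q → memₚ q D) C)
  of-⊆ C D C⊆D = All.all⁻ _ (tabulate (Equivalence.from (memₚ⇔∈ _ D) ∘ C⊆D))
  to : T (sameSetₚ A B) → SameSet A B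
  to t = let A⊆ , B⊆ = Equivalence.to T-∧ t in ⊆-of A B A⊆ , ⊆-of B A B⊆
  from : SameSet A B → T (sameSetₚ A B)
  from (A⊆B , B⊆A) = Equivalence.from T-∧ (of-⊆ A B A⊆B , of-⊆ B A B⊆A)

firstOccFrom : ℕ → List ℕ → List ℕ → List (ℕ × ℕ)
firstOccFrom i S []      = []
firstOccFrom i S (v ∷ w) with v ∈? S
... | yes _ = firstOccFrom (suc i) (v ∷ S) w
... | no  _ = (i , v) ∷ firstOccFrom (suc i) (v ∷ S) w

FirstOccAt : ℕ → ℕ → List ℕ → ℕ → List ℕ → Set
FirstOccAt i j S i₀ w = j ∉ S × j ∈ w × i ≡ firstPosFrom i₀ j w

FirstOccAt-∷ : ∀ {i j S i₀ v w} → FirstOccAt i j (v ∷ S) (suc i₀) w → FirstOccAt i j S i₀ (v ∷ w)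
FirstOccAt-∷ (j∉ , j∈ , eq) rewrite ≡ᵇ-false (j∉ ∘ here) = j∉ ∘ there , there j∈ , eq

firstOccFrom-∈⁻ : ∀ {i j} i₀ S w → (i , j) ∈ firstOccFrom i₀ S w → FirstOccAt i j S i₀ w
firstOccFrom-∈⁻ i₀ S (v ∷ w) q∈ with v ∈? S
... | yes _ = FirstOccAt-∷ (firstOccFrom-∈⁻ (suc i₀) (v ∷ S) w q∈)
... | no v∉S with q∈
...   | here refl rewrite ≡ᵇ-refl v = v∉S , here refl , refl
...   | there q∈′ = FirstOccAt-∷ (firstOccFrom-∈⁻ (suc i₀) (v ∷ S) w q∈′)

firstOccFrom-∈⁺ : ∀ {j} i₀ S w → j ∉ S → j ∈ w → (firstPosFrom i₀ j w , j) ∈ firstOccFrom i₀ S w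
firstOccFrom-∈⁺ {j} i₀ S (v ∷ w) j∉S j∈ with j ≟ v
... | yes refl rewrite ≡ᵇ-refl j with j ∈? S
...   | yes j∈S = ⊥-elim (j∉S j∈S)
...   | no _    = here refl
firstOccFrom-∈⁺ {j} i₀ S (v ∷ w) j∉S (here j≡v)  | no j≢v = ⊥-elim (j≢v j≡v)
firstOccFrom-∈⁺ {j} i₀ S (v ∷ w) j∉S (there j∈w) | no j≢v rewrite ≡ᵇ-false j≢v with v ∈? S
... | yes _ = firstOccFrom-∈⁺ (suc i₀) (v ∷ S) w (λ { (here j≡v) → j≢v j≡v ; (there j∈S) → j∉S j∈S }) j∈w
... | no  _ = there (firstOccFrom-∈⁺ (suc i₀) (v ∷ S) w (λ { (here j≡v) → j≢v j≡v ; (there j∈S) → j∉S j∈S }) j∈w)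

leftmostCopies≈firstOcc : ∀ x → Cayley x → SameSet (leftmostCopies x) (firstOccFrom 1 [] x)
leftmostCopies≈firstOcc x (pos , onto) = lc⊆fo , fo⊆lc
  where
  lc⊆fo : leftmostCopies x ⊆ firstOccFrom 1 [] x
  lc⊆fo q∈ with ∈-map⁻ _ q∈
  ... | j , j∈ , refl with ∈-applyUpTo⁻ suc j∈
  ... | i , i<max , refl = firstOccFrom-∈⁺ 1 [] x (λ ()) (onto i<max)
  fo⊆lc : firstOccFrom 1 [] x ⊆ leftmostCopies x
  fo⊆lc {i , j} q∈ with firstOccFrom-∈⁻ 1 [] x q∈
  ... | _ , j∈x , refl with lookup pos j∈x
  ... | s≤s {n = j′} _ = ∈-map⁺ _ (∈-applyUpTo⁺ suc (∈⇒≤maxL x j∈x))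

ascTopsFrom-≥ : ∀ {q} i p w → q ∈ ascTopsFrom i p w → i ≤ proj₁ q
ascTopsFrom-≥ i p (b ∷ w) q∈ with p <ᵇ b
ascTopsFrom-≥ i p (b ∷ w) (here refl) | true  = ≤-refl
ascTopsFrom-≥ i p (b ∷ w) (there q∈)  | true  = <⇒≤ (ascTopsFrom-≥ (suc i) b w q∈)
ascTopsFrom-≥ i p (b ∷ w) q∈          | false = <⇒≤ (ascTopsFrom-≥ (suc i) b w q∈)

firstOccFrom-≥ : ∀ {q} i S w → q ∈ firstOccFrom i S w → i ≤ proj₁ q
firstOccFrom-≥ i S (b ∷ w) q∈ with b ∈? S
firstOccFrom-≥ i S (b ∷ w) q∈          | yes _ = <⇒≤ (firstOccFrom-≥ (suc i) (b ∷ S) w q∈)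
firstOccFrom-≥ i S (b ∷ w) (here refl) | no _  = ≤-refl
firstOccFrom-≥ i S (b ∷ w) (there q∈)  | no _  = <⇒≤ (firstOccFrom-≥ (suc i) (b ∷ S) w q∈)

SameSet-∷ : ∀ {h A B} → SameSet A B → SameSet (h ∷ A) (h ∷ B)
SameSet-∷ (A⊆B , B⊆A) = (λ { (here e) → here e ; (there q∈) → there (A⊆B q∈) })
                      , (λ { (here e) → here e ; (there q∈) → there (B⊆A q∈) })

SameSet-∷⁻ : ∀ {h A B} → All (λ q → proj₁ h < proj₁ q) A → All (λ q → proj₁ h < proj₁ q) B →
             SameSet (h ∷ A) (h ∷ B) → SameSet A B
SameSet-∷⁻ {h} h<A h<B (A⊆ , B⊆) = (λ q∈ → drop-head (A⊆ (there q∈)) (lookup h<A q∈))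
                                  , (λ q∈ → drop-head (B⊆ (there q∈)) (lookup h<B q∈))
  where
  drop-head : ∀ {q C} → q ∈ h ∷ C → proj₁ h < proj₁ q → q ∈ C
  drop-head (here refl) h<q = ⊥-elim (<-irrefl refl h<q)
  drop-head (there q∈)  _   = q∈

SameSet-trans : ∀ {A B C} → SameSet A B → SameSet B C → SameSet A C
SameSet-trans (A⊆B , B⊆A) (B⊆C , C⊆B) = B⊆C ∘ A⊆B , B⊆A ∘ C⊆B

NewAtTops⇒SameSet : ∀ i S p w → NewAtTops S p w → SameSet (ascTopsFrom i p w) (firstOccFrom i S w)
NewAtTops⇒SameSet i S p []      []                = (λ ()) , (λ ())
NewAtTops⇒SameSet i S p (v ∷ w) (new v∉S p<v n) rewrite <ᵇ-true p<v with v ∈? S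
... | yes v∈S = ⊥-elim (v∉S v∈S)
... | no  _   = SameSet-∷ (NewAtTops⇒SameSet (suc i) (v ∷ S) v w n)
NewAtTops⇒SameSet i S p (v ∷ w) (old v∈S v≤p n) rewrite <ᵇ-false v≤p with v ∈? S
... | yes _   = NewAtTops⇒SameSet (suc i) (v ∷ S) v w n
... | no v∉S  = ⊥-elim (v∉S v∈S)

SameSet⇒NewAtTops : ∀ i S p w → SameSet (ascTopsFrom i p w) (firstOccFrom i S w) → NewAtTops S p w
SameSet⇒NewAtTops i S p []      _  = []
SameSet⇒NewAtTops i S p (v ∷ w) eq with p <ᵇ v | <ᵇ-reflects-< p v | v ∈? S
... | true  | ofʸ p<v | no v∉S  = new v∉S p<v (SameSet⇒NewAtTops (suc i) (v ∷ S) v w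
        (SameSet-∷⁻ (tabulate (ascTopsFrom-≥ (suc i) v w)) (tabulate (firstOccFrom-≥ (suc i) (v ∷ S) w)) eq))
... | true  | ofʸ _   | yes _   = ⊥-elim (1+n≰n (firstOccFrom-≥ (suc i) (v ∷ S) w (proj₁ eq (here refl))))
... | false | ofⁿ p≮v | yes v∈S = old v∈S (≮⇒≥ p≮v) (SameSet⇒NewAtTops (suc i) (v ∷ S) v w eq)
... | false | ofⁿ _   | no _    = ⊥-elim (1+n≰n (ascTopsFrom-≥ (suc i) v w (proj₂ eq (here refl))))

-- The letters of a Cayley permutation are positive, so its first letter is an ascent top.
modAscent⇔NewAtTops : ∀ x → Cayley x → T (sameSetₚ (ascTops x) (leftmostCopies x)) ⇔ NewAtTops [] 0 x
modAscent⇔NewAtTops [] _ = mk⇔ (λ _ → []) (λ _ → tt)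
modAscent⇔NewAtTops (a ∷ w) cay@(0<a ∷ _ , _) = mk⇔ to from
  where
  lc≈fo : SameSet (leftmostCopies (a ∷ w)) (firstOccFrom 1 [] (a ∷ w))
  lc≈fo = leftmostCopies≈firstOcc (a ∷ w) cay
  to : T (sameSetₚ (ascTops (a ∷ w)) (leftmostCopies (a ∷ w))) → NewAtTops [] 0 (a ∷ w)
  to t = new (λ ()) 0<a (SameSet⇒NewAtTops 2 [ a ] a w
    (SameSet-∷⁻ (tabulate (ascTopsFrom-≥ 2 a w)) (tabulate (firstOccFrom-≥ 2 [ a ] w))
      (SameSet-trans (Equivalence.to (sameSetₚ⇔ _ _) t) lc≈fo)))
  from : NewAtTops [] 0 (a ∷ w) → T (sameSetₚ (ascTops (a ∷ w)) (leftmostCopies (a ∷ w)))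
  from (new _ _ n) = Equivalence.from (sameSetₚ⇔ _ _)
    (SameSet-trans (SameSet-∷ (NewAtTops⇒SameSet 2 [ a ] a w n)) (proj₂ lc≈fo , proj₁ lc≈fo))

∈subseqs⇔⊑ : ∀ {s} x → s ∈ subseqs x ⇔ s ⊑ x
∈subseqs⇔⊑ x = mk⇔ (to x) from
  where
  to : ∀ {s} x → s ∈ subseqs x → s ⊑ x
  to []      (here refl) = []
  to (v ∷ x) s∈ with ∈-++⁻ (map (v ∷_) (subseqs x)) s∈
  ... | inj₂ s∈′ = v ∷ʳ to x s∈′
  ... | inj₁ s∈′ with ∈-map⁻ (v ∷_) s∈′
  ...   | _ , s∈″ , refl = refl ∷ to x s∈″
  from : ∀ {s x} → s ⊑ x → s ∈ subseqs x
  from []                  = here refl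
  from (_∷ʳ_ {ys = x} v s⊑) = ∈-++⁺ʳ (map (v ∷_) (subseqs x)) (from s⊑)
  from (refl ∷ s⊑)         = ∈-++⁺ˡ (∈-map⁺ _ (from s⊑))

⊑-∷⁻ : ∀ {a : ℕ} {s x} → a ∷ s ⊑ x → ∃[ u₁ ] ∃[ u₂ ] x ≡ u₁ ++ a ∷ u₂ × s ⊑ u₂
⊑-∷⁻ (y ∷ʳ as⊑) with ⊑-∷⁻ as⊑
... | u₁ , u₂ , refl , s⊑ = y ∷ u₁ , u₂ , refl , s⊑
⊑-∷⁻ (refl ∷ s⊑) = [] , _ , refl , s⊑

Contains2321 : List ℕ → Set
Contains2321 x = ∃[ a ] ∃[ b ] ∃[ c ] a < b × c < a × a ∷ b ∷ a ∷ c ∷ [] ⊑ x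

orderIso⇒length≡ : ∀ s t → T (orderIso s t) → length s ≡ length t
orderIso⇒length≡ []      []      _  = refl
orderIso⇒length≡ (a ∷ s) (b ∷ t) oi = cong suc (orderIso⇒length≡ s t (proj₂ (Equivalence.to T-∧ oi)))

orderIso-2321⁻ : ∀ a b a′ c → T (orderIso (a ∷ b ∷ a′ ∷ c ∷ []) pattern2321) →
                 T (sameOrder a b 2 3) × T (sameOrder a a′ 2 2) × T (sameOrder a c 2 1)
orderIso-2321⁻ a b a′ c oi with sameOrder a b 2 3 | sameOrder a a′ 2 2 | sameOrder a c 2 1
... | true  | true  | true  = tt , tt , tt
... | false | _     | _     = ⊥-elim oi
... | true  | false | _     = ⊥-elim oi
... | true  | true  | false = ⊥-elim oi

sameOrder-23 : ∀ a a′ → T (sameOrder a a′ 2 3) → a < a′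
sameOrder-23 a a′ t with a <ᵇ a′ | <ᵇ-reflects-< a a′
... | true  | ofʸ a<a′ = a<a′
... | false | _       = ⊥-elim t

sameOrder-22 : ∀ a a′ → T (sameOrder a a′ 2 2) → a ≡ a′
sameOrder-22 a a′ t with a <ᵇ a′ | a′ <ᵇ a | a ≡ᵇ a′ | ≡ᵇ-reflects-≡ a a′
... | false | false | true  | ofʸ a≡a′ = a≡a′
... | true  | _     | _     | _       = ⊥-elim t
... | false | true  | _     | _       = ⊥-elim t
... | false | false | false | _       = ⊥-elim t

sameOrder-21 : ∀ a c → T (sameOrder a c 2 1) → c < a
sameOrder-21 a c t with a <ᵇ c | c <ᵇ a | <ᵇ-reflects-< c a
... | false | true  | ofʸ c<a = c<a
... | true  | _     | _       = ⊥-elim t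
... | false | false | _       = ⊥-elim t

orderIso2321⇔ : ∀ s → T (orderIso s pattern2321) ⇔ (∃[ a ] ∃[ b ] ∃[ c ] a < b × c < a × s ≡ a ∷ b ∷ a ∷ c ∷ [])
orderIso2321⇔ s = mk⇔ (to s) from
  where
  to : ∀ s → T (orderIso s pattern2321) → ∃[ a ] ∃[ b ] ∃[ c ] a < b × c < a × s ≡ a ∷ b ∷ a ∷ c ∷ []
  to s oi with orderIso⇒length≡ s pattern2321 oi
  to (a ∷ b ∷ a′ ∷ c ∷ []) oi | _ with orderIso-2321⁻ a b a′ c oi
  ... | ab , aa′ , ac with sameOrder-22 a a′ aa′
  ...   | refl = a , b , c , sameOrder-23 a b ab , sameOrder-21 a c ac , refl
  from : (∃[ a ] ∃[ b ] ∃[ c ] a < b × c < a × s ≡ a ∷ b ∷ a ∷ c ∷ []) → T (orderIso s pattern2321)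
  from (a , b , c , a<b , c<a , refl)
    rewrite <ᵇ-true a<b | <ᵇ-false (<⇒≤ a<b) | ≡ᵇ-false (<⇒≢ a<b) | ≡ᵇ-false (≢-sym (<⇒≢ a<b))
          | <ᵇ-false (≤-refl {a}) | ≡ᵇ-refl a
          | <ᵇ-true c<a | <ᵇ-false (<⇒≤ c<a) | ≡ᵇ-false (≢-sym (<⇒≢ c<a))
          | <ᵇ-true (<-trans c<a a<b) | <ᵇ-false (<⇒≤ (<-trans c<a a<b)) | ≡ᵇ-false (≢-sym (<⇒≢ (<-trans c<a a<b)))
    = tt

contains2321⇔ : ∀ x → T (contains x pattern2321) ⇔ Contains2321 x
contains2321⇔ x = mk⇔ to from
  where
  to : T (contains x pattern2321) → Contains2321 x
  to t with find (Any.any⁻ _ (subseqs x) t)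
  ... | s , s∈ , oi with Equivalence.to (orderIso2321⇔ s) oi
  ...   | a , b , c , a<b , c<a , refl = a , b , c , a<b , c<a , Equivalence.to (∈subseqs⇔⊑ x) s∈
  from : Contains2321 x → T (contains x pattern2321)
  from (a , b , c , a<b , c<a , occ) =
    Any.any⁺ _ (Any.map (λ { refl → Equivalence.from (orderIso2321⇔ _) (a , b , c , a<b , c<a , refl) })
                        (Equivalence.from (∈subseqs⇔⊑ x) occ))

-- In a 2321 occurrence a b a c the second a is a repeated letter following b ≠ a,
-- so nothing after it, in particular c, is below a.
good⇒¬2321 : ∀ {x} → NewAtTops [] 0 x → AboveFloor 0 0 x → ¬ Contains2321 x
good⇒¬2321 n f (a , b , c , a<b , c<a , occ) with ⊑-∷⁻ occ
... | u₁ , _ , refl , occ₁ with ⊑-∷⁻ occ₁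
... | u₂ , _ , refl , occ₂ with ⊑-∷⁻ occ₂
... | u₃ , _ , refl , occ₃ with ⊑-∷⁻ occ₃
... | u₄ , u₅ , refl , _ = <⇒≱ c<a (lookup a≤rest (∈-++⁺ʳ u₄ (here refl)))
  where
  U = u₁ ++ a ∷ u₂ ++ [ b ]
  regroup : u₁ ++ a ∷ u₂ ++ b ∷ u₃ ++ a ∷ u₄ ++ c ∷ u₅ ≡ U ++ u₃ ++ a ∷ u₄ ++ c ∷ u₅
  regroup = trans (cong (λ z → u₁ ++ a ∷ z) (sym (++-assoc u₂ [ b ] _))) (sym (++-assoc u₁ (a ∷ u₂ ++ [ b ]) _))
  last≡b : lastOr 0 U ≡ b
  last≡b = trans (cong (lastOr 0) (sym (++-assoc u₁ (a ∷ u₂) [ b ]))) (lastOr-∷ʳ 0 (u₁ ++ a ∷ u₂) b)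
  nU : NewAtTops [] 0 U × NewAtTops (reverseAcc [] U) (lastOr 0 U) (u₃ ++ a ∷ u₄ ++ c ∷ u₅)
  nU = NewAtTops-++⁻ U (subst (NewAtTops [] 0) regroup n)
  fU : AboveFloor 0 0 U × AboveFloor (lastOr 0 U) (floorAfter 0 0 U) (u₃ ++ a ∷ u₄ ++ c ∷ u₅)
  fU = AboveFloor-++⁻ U (subst (AboveFloor 0 0) regroup f)
  a≤rest : All (a ≤_) (u₄ ++ c ∷ u₅)
  a≤rest = above-later-repeat u₃ (∈-reverseAccʳ [] U (∈-++⁺ʳ u₁ (here refl))) (<⇒≢ (subst (a <_) (sym last≡b) a<b))
             (proj₂ nU) (proj₂ fU)

-- The floor is 0 or the bottom d of an occurrence of d b d with d < b, so that a later
-- letter below the floor would complete a 2321.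
FloorWitness : ℕ → List ℕ → Set
FloorWitness d u = d ≡ 0 ⊎ ∃[ b ] d < b × d ∷ b ∷ d ∷ [] ⊑ u

FloorWitness-∷ʳ : ∀ {d u} v → FloorWitness d u → FloorWitness d (u ++ [ v ])
FloorWitness-∷ʳ v (inj₁ d≡0)              = inj₁ d≡0
FloorWitness-∷ʳ v (inj₂ (b , d<b , dbd⊑u)) = inj₂ (b , d<b , Sublist.++⁺ʳ [ v ] dbd⊑u)

FloorWitness-below : ∀ {d u v} w → FloorWitness d u → v < d → Contains2321 (u ++ v ∷ w)
FloorWitness-below w (inj₁ refl) ()
FloorWitness-below w (inj₂ (b , d<b , dbd⊑u)) v<d = _ , b , _ , d<b , v<d , Sublist.++⁺ dbd⊑u (refl ∷ minimum w)

∈-then-last : ∀ {v} q u → v ∈ u → v ≢ lastOr q u → v ∷ lastOr q u ∷ [] ⊑ u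
∈-then-last q (a ∷ u)     (there v∈u) v≢last = a ∷ʳ ∈-then-last a u v∈u v≢last
∈-then-last q (a ∷ [])    (here refl) v≢last = ⊥-elim (v≢last refl)
∈-then-last q (a ∷ b ∷ u) (here refl) v≢last = refl ∷ from∈ (lastOr-∈ a (b ∷ u) (λ ()))

¬2321⇒AboveFloor : ∀ u {S d} w → S ⊆ u → FloorWitness d u → NewAtTops S (lastOr 0 u) w →
                   ¬ Contains2321 (u ++ w) → AboveFloor (lastOr 0 u) d w
¬2321⇒AboveFloor u []      _   _  _ _     = []
¬2321⇒AboveFloor u {S} {d} (v ∷ w) S⊆u fw n avoid = step n
  where
  u′ = u ++ [ v ]
  last≡v : lastOr 0 u′ ≡ v
  last≡v = lastOr-∷ʳ 0 u v
  next : ∀ {d′} → FloorWitness d′ u′ → AboveFloor v d′ w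
  next fw′ = subst (λ p → AboveFloor p _ w) last≡v
    (¬2321⇒AboveFloor u′ w (λ { (here refl) → ∈-++⁺ʳ u (here refl) ; (there a∈S) → ∈-++⁺ˡ (S⊆u a∈S) }) fw′
      (subst (λ p → NewAtTops (v ∷ S) p w) (sym last≡v) (NewAtTops-tail n))
      (avoid ∘ subst Contains2321 (++-assoc u [ v ] w)))
  step : NewAtTops S (lastOr 0 u) (v ∷ w) → AboveFloor (lastOr 0 u) d (v ∷ w)
  step (new _ p<v _) = up (<⇒≤ p<v) (next (FloorWitness-∷ʳ v fw))
  step (old v∈S v≤p _) with m≤n⇒m<n∨m≡n v≤p
  ... | inj₂ refl = up ≤-refl (next (FloorWitness-∷ʳ v fw))
  ... | inj₁ v<p with _ ≤? v
  ...   | yes d≤v = down v<p d≤v (next (inj₂ (lastOr 0 u , v<p ,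
                      Sublist.++⁺ (∈-then-last 0 u (S⊆u v∈S) (<⇒≢ v<p)) (refl ∷ []))))
  ...   | no d≰v = ⊥-elim (avoid (FloorWitness-below w fw (≰⇒> d≰v)))

Good : List ℕ → Set
Good x = Cayley x × NewAtTops [] 0 x × AboveFloor 0 0 x

T-not : ∀ b → T (not b) ⇔ (¬ T b)
T-not true  = mk⇔ (λ ()) (λ ¬t → ¬t tt)
T-not false = mk⇔ (λ _ ()) (λ _ → tt)

good⇔ : ∀ x → T (isModAscent x ∧ avoids x pattern2321) ⇔ Good x
good⇔ x = mk⇔ to from
  where
  to : T (isModAscent x ∧ avoids x pattern2321) → Good x
  to t =
    let mas , avoid = Equivalence.to T-∧ t
        cay , tops  = Equivalence.to T-∧ mas
        c = Equivalence.to (isCayley⇔ x) cay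
        n = Equivalence.to (modAscent⇔NewAtTops x c) tops
        ¬2321 = Equivalence.to (T-not _) avoid ∘ Equivalence.from (contains2321⇔ x)
    in c , n , ¬2321⇒AboveFloor [] x (λ ()) (inj₁ refl) n ¬2321
  from : Good x → T (isModAscent x ∧ avoids x pattern2321)
  from (c , n , f) = Equivalence.from T-∧
    (Equivalence.from T-∧ (Equivalence.from (isCayley⇔ x) c , Equivalence.from (modAscent⇔NewAtTops x c) n) ,
     Equivalence.from (T-not _) (good⇒¬2321 n f ∘ Equivalence.to (contains2321⇔ x)))

-- The generating tree

NewAtTops-plateau⁺ : ∀ {S p vs w} → All (_≡ p) vs → p ∈ S → NewAtTops S p w → NewAtTops S p (vs ++ w)
NewAtTops-plateau⁺ []           p∈S n = n
NewAtTops-plateau⁺ (refl ∷ vs≡) p∈S n = old p∈S ≤-refl (NewAtTops-plateau⁺ vs≡ (here refl) (NewAtTops-repeat p∈S n))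

NewAtTops-plateau⁻ : ∀ {S p vs w} → All (_≡ p) vs → p ∈ S → NewAtTops S p (vs ++ w) → NewAtTops S p w
NewAtTops-plateau⁻ []           p∈S n = n
NewAtTops-plateau⁻ (refl ∷ vs≡) p∈S n = NewAtTops-absorb p∈S (NewAtTops-plateau⁻ vs≡ (here refl) (NewAtTops-tail n))

AboveFloor-plateau⁺ : ∀ {p d vs w} → All (_≡ p) vs → AboveFloor p d w → AboveFloor p d (vs ++ w)
AboveFloor-plateau⁺ []           f = f
AboveFloor-plateau⁺ (refl ∷ vs≡) f = up ≤-refl (AboveFloor-plateau⁺ vs≡ f)

AboveFloor-plateau⁻ : ∀ {p d vs w} → All (_≡ p) vs → AboveFloor p d (vs ++ w) → AboveFloor p d w
AboveFloor-plateau⁻ []           f                = f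
AboveFloor-plateau⁻ (refl ∷ vs≡) (up _ f)         = AboveFloor-plateau⁻ vs≡ f
AboveFloor-plateau⁻ (refl ∷ vs≡) (down p<p _ _)   = ⊥-elim (<-irrefl refl p<p)

AboveFloor-restart : ∀ {p d p′ d′ w} → Maybe.All (p′ ≤_) (head w) → All (d′ ≤_) w → AboveFloor p d w → AboveFloor p′ d′ w
AboveFloor-restart _           _            []           = []
AboveFloor-restart (just p′≤b) (_ ∷ d′≤w)  (up _ f)     = up p′≤b (AboveFloor-refloor d′≤w f)
AboveFloor-restart (just p′≤b) (_ ∷ d′≤w)  (down _ _ f) = up p′≤b (AboveFloor-refloor d′≤w f)

All⇒head : ∀ {P : ℕ → Set} {w} → All P w → Maybe.All P (head w)
All⇒head []       = nothing
All⇒head (Pb ∷ _) = just Pb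

-- The maximum, once read, can only reappear as an ascent top, which it cannot be.
max-not-again : ∀ {M S p w} → M ∈ S → p < M → All (_≤ M) w → NewAtTops S p w → M ∉ w
max-not-again M∈S p<M (b≤M ∷ w≤M) n M∈ with m≤n⇒m<n∨m≡n b≤M
max-not-again M∈S p<M (b≤M ∷ w≤M) (new M∉S _ _) M∈          | inj₂ refl = M∉S M∈S
max-not-again M∈S p<M (b≤M ∷ w≤M) (old _ M≤p _) M∈          | inj₂ refl = <⇒≱ p<M M≤p
max-not-again M∈S p<M (b≤M ∷ w≤M) n             (here refl) | inj₁ M<M  = <-irrefl refl M<M
max-not-again M∈S p<M (b≤M ∷ w≤M) n             (there M∈w) | inj₁ b<M  =
  max-not-again (there M∈S) b<M w≤M (NewAtTops-tail n) M∈w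

maxL-mono : ∀ x y → x ⊆ y → maxL x ≤ maxL y
maxL-mono x y x⊆y = maxL≤ x (tabulate (∈⇒≤maxL y ∘ x⊆y))

Cayley-sameLetters : ∀ x y → x ⊆ y → y ⊆ x → Cayley x → Cayley y
Cayley-sameLetters x y x⊆y y⊆x (pos , onto) =
  tabulate (lookup pos ∘ y⊆x) , λ i<max → x⊆y (onto (<-≤-trans i<max (maxL-mono y x y⊆x)))

newMax : List ℕ → ℕ
newMax x = suc (maxL x)

↭-letters : ∀ {x y : List ℕ} {M u} → y ↭ M ∷ x → u ∈ y → u ∈ x ⊎ u ≡ M
↭-letters y↭ u∈y with ∈-resp-↭ y↭ u∈y
... | here u≡M  = inj₂ u≡M
... | there u∈x = inj₁ u∈x

Cayley-↭-add : ∀ {x y} → y ↭ newMax x ∷ x → Cayley x → Cayley y × maxL y ≡ newMax x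
Cayley-↭-add {x} {y} y↭ (pos , onto) = (tabulate (positive ∘ ↭-letters y↭) , onto′) , maxL≡
  where
  M∈y : newMax x ∈ y
  M∈y = ∈-resp-↭ (↭-sym y↭) (here refl)
  bounded : ∀ {u} → u ∈ x ⊎ u ≡ newMax x → u ≤ newMax x
  bounded (inj₁ u∈x)  = m≤n⇒m≤1+n (∈⇒≤maxL x u∈x)
  bounded (inj₂ refl) = ≤-refl
  positive : ∀ {u} → u ∈ x ⊎ u ≡ newMax x → 1 ≤ u
  positive (inj₁ u∈x)  = lookup pos u∈x
  positive (inj₂ refl) = s≤s z≤n
  maxL≡ : maxL y ≡ newMax x
  maxL≡ = ≤-antisym (maxL≤ y (tabulate (bounded ∘ ↭-letters y↭))) (∈⇒≤maxL y M∈y)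
  onto′ : ∀ {i} → i < maxL y → suc i ∈ y
  onto′ i<max with m≤n⇒m<n∨m≡n (s≤s⁻¹ (subst (_ <_) maxL≡ i<max))
  ... | inj₁ i<maxx = ∈-resp-↭ (↭-sym y↭) (there (onto i<maxx))
  ... | inj₂ refl   = M∈y

Cayley-↭-remove : ∀ {x y M} → y ↭ M ∷ x → maxL y ≡ M → M ∉ x → 1 ≤ M → Cayley y → Cayley x × newMax x ≡ M
Cayley-↭-remove {x} {y} y↭ refl M∉x 1≤max (pos , onto) = (tabulate (lookup pos ∘ x⊆y) , onto′) , maxL≡
  where
  x⊆y : x ⊆ y
  x⊆y = ∈-resp-↭ (↭-sym y↭) ∘ there
  y⊆ : ∀ {u} → u ∈ y → u ≢ maxL y → u ∈ x
  y⊆ u∈y u≢M with ↭-letters y↭ u∈y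
  ... | inj₁ u∈x = u∈x
  ... | inj₂ u≡M = ⊥-elim (u≢M u≡M)
  below : ∀ {u} → u ∈ x → u < maxL y
  below u∈x = ≤∧≢⇒< (∈⇒≤maxL y (x⊆y u∈x)) (λ { refl → M∉x u∈x })
  maxx<maxy : maxL x < maxL y
  maxx<maxy with 0 <? maxL x
  ... | yes 0<max = below (maxL∈ x 0<max)
  ... | no  0≮max = subst (_< maxL y) (sym (n≤0⇒n≡0 (≮⇒≥ 0≮max))) 1≤max
  maxy≤ : ∀ M → M ≡ maxL y → M ≤ newMax x
  maxy≤ zero          _  = z≤n
  maxy≤ (suc zero)    _  = s≤s z≤n
  maxy≤ (suc (suc k)) eq = s≤s (∈⇒≤maxL x (y⊆ (onto (subst (k <_) eq (m≤n⇒m≤1+n (n<1+n k))))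
                                              λ eq′ → <-irrefl (trans eq′ (sym eq)) (n<1+n (suc k))))
  maxL≡ : newMax x ≡ maxL y
  maxL≡ = ≤-antisym maxx<maxy (maxy≤ (maxL y) refl)
  onto′ : ∀ {i} → i < maxL x → suc i ∈ x
  onto′ i<max = y⊆ (onto (<-trans i<max maxx<maxy)) (λ eq → <-irrefl eq (≤-<-trans i<max maxx<maxy))

LastSatisfies : (ℕ → Set) → List ℕ → Set
LastSatisfies P []       = ⊤
LastSatisfies P (b ∷ bs) = P (lastOr b bs)

-- spanLast P? xs cuts xs just after its last letter satisfying P.
spanLast : ∀ {P : ℕ → Set} → Decidable P → List ℕ → List ℕ × List ℕ
spanLast P? []       = [] , []
spanLast P? (b ∷ bs) with spanLast P? bs
... | y ∷ ys , zs = b ∷ y ∷ ys , zs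
... | []     , zs with does (P? b)
...   | true  = [ b ] , zs
...   | false = [] , b ∷ zs

module _ {P : ℕ → Set} (P? : Decidable P) where

  spanLast-++ : ∀ xs → proj₁ (spanLast P? xs) ++ proj₂ (spanLast P? xs) ≡ xs
  spanLast-++ []       = refl
  spanLast-++ (b ∷ bs) with spanLast P? bs | spanLast-++ bs
  ... | y ∷ ys , zs | eq = cong (b ∷_) eq
  ... | []     , zs | eq with does (P? b)
  ...   | true  = cong (b ∷_) eq
  ...   | false = cong (b ∷_) eq

  spanLast-last : ∀ xs → LastSatisfies P (proj₁ (spanLast P? xs))
  spanLast-last []       = tt
  spanLast-last (b ∷ bs) with spanLast P? bs | spanLast-last bs
  ... | y ∷ ys , zs | last = last
  ... | []     , zs | _ with P? b
  ...   | yes Pb = Pb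
  ...   | no  _  = tt

  spanLast-rest : ∀ xs → All (∁ P) (proj₂ (spanLast P? xs))
  spanLast-rest []       = []
  spanLast-rest (b ∷ bs) with spanLast P? bs | spanLast-rest bs
  ... | y ∷ ys , zs | rest = rest
  ... | []     , zs | rest with P? b
  ...   | yes _   = rest
  ...   | no  ¬Pb = ¬Pb ∷ rest

  spanLast-none : ∀ {zs} → All (∁ P) zs → spanLast P? zs ≡ ([] , zs)
  spanLast-none []                    = refl
  spanLast-none {z ∷ zs} (¬Pz ∷ rest) rewrite spanLast-none rest | dec-false (P? z) ¬Pz = refl

  spanLast-char : ∀ ys {zs} → LastSatisfies P ys → All (∁ P) zs → spanLast P? (ys ++ zs) ≡ (ys , zs)
  spanLast-char []           _  rest = spanLast-none rest
  spanLast-char (b ∷ [])     Pb rest rewrite spanLast-none rest | dec-true (P? b) Pb = refl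
  spanLast-char (b ∷ y ∷ ys) ls rest rewrite spanLast-char (y ∷ ys) ls rest = refl

  takeWhile-++ : ∀ xs {ys} → All P xs → Maybe.All (∁ P) (head ys) → takeWhile P? (xs ++ ys) ≡ xs
  takeWhile-++ []       {[]}    []         _          = refl
  takeWhile-++ []       {y ∷ _} []         (just ¬Py) rewrite dec-false (P? y) ¬Py = refl
  takeWhile-++ (x ∷ xs)         (Px ∷ Pxs) hd         rewrite dec-true (P? x) Px = cong (x ∷_) (takeWhile-++ xs Pxs hd)

  dropWhile-++ : ∀ xs {ys} → All P xs → Maybe.All (∁ P) (head ys) → dropWhile P? (xs ++ ys) ≡ ys
  dropWhile-++ []       {[]}    []         _          = refl
  dropWhile-++ []       {y ∷ _} []         (just ¬Py) rewrite dec-false (P? y) ¬Py = refl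
  dropWhile-++ (x ∷ xs)         (Px ∷ Pxs) hd         rewrite dec-true (P? x) Px = dropWhile-++ xs Pxs hd

_≢?_ : Decidable₂ (λ (b M : ℕ) → b ≢ M)
b ≢? M = ¬? (b ≟ M)

∈⇒first : ∀ {M : ℕ} {y} → M ∈ y → ∃[ P ] ∃[ R ] y ≡ P ++ M ∷ R × M ∉ P
∈⇒first {M} {b ∷ y} M∈ with b ≟ M
... | yes refl = [] , y , refl , λ ()
... | no b≢M with M∈
...   | here M≡b = ⊥-elim (b≢M (sym M≡b))
...   | there M∈y with ∈⇒first M∈y
...     | P , R , refl , M∉P = b ∷ P , R , refl , λ { (here M≡b) → b≢M (sym M≡b) ; (there M∈P) → M∉P M∈P }

takeWhile-≢-first : ∀ {M : ℕ} P {R} → M ∉ P → takeWhile (_≢? M) (P ++ M ∷ R) ≡ P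
takeWhile-≢-first P M∉P = takeWhile-++ (_≢? _) P (tabulate λ { M∈P refl → M∉P M∈P }) (just λ M≢M → M≢M refl)

dropWhile-≢-first : ∀ {M : ℕ} P {R} → M ∉ P → dropWhile (_≢? M) (P ++ M ∷ R) ≡ M ∷ R
dropWhile-≢-first P M∉P = dropWhile-++ (_≢? _) P (tabulate λ { M∈P refl → M∉P M∈P }) (just λ M≢M → M≢M refl)

duplicateMax : List ℕ → List ℕ
duplicateMax x = takeWhile (_≢? maxL x) x ++ maxL x ∷ dropWhile (_≢? maxL x) x

-- With R = v vs B₁ B₂, where vs repeats v and B₁ ends at the last later letter below v,
-- A R becomes A B₁ M v vs B₂.
insertNewMax : ℕ → List ℕ → List ℕ → List ℕ
insertNewMax M A []      = A ++ [ M ]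
insertNewMax M A (v ∷ R) = A ++ proj₁ (spanLast (_<? v) (dropWhile (_≟ v) R))
                             ++ M ∷ v ∷ takeWhile (_≟ v) R ++ proj₂ (spanLast (_<? v) (dropWhile (_≟ v) R))

child : List ℕ → ℕ → List ℕ
child x zero    = duplicateMax x
child x (suc p) = insertNewMax (newMax x) (take (suc p) x) (drop (suc p) x)

-- Mark 0 duplicates the maximum; a positive mark is the length of a prefix that is
-- followed by nothing or by a weak descent.
marksFrom : ℕ → ℕ → List ℕ → List ℕ
marksFrom i q []      = [ i ]
marksFrom i q (v ∷ w) with v ≤? q
... | yes _ = i ∷ marksFrom (suc i) v w
... | no  _ = marksFrom (suc i) v w

marks : List ℕ → List ℕ
marks []      = []
marks (a ∷ w) = 0 ∷ marksFrom 1 a w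

-- Inverse of child, given the word P M R with M the maximum and M ∉ P.
removeMax : ℕ → List ℕ → List ℕ → List ℕ × ℕ
removeMax M P []      = P , length P
removeMax M P (d ∷ R) with d ≟ M | d ≤? lastOr 0 P
... | yes _ | _     = P ++ d ∷ R , 0
... | no  _ | yes _ = P ++ d ∷ R , length P
... | no  _ | no  _ = proj₁ (spanLast (_≟ d) P) ++ d ∷ takeWhile (_≟ d) R ++ proj₂ (spanLast (_≟ d) P) ++ dropWhile (_≟ d) R
                    , length (proj₁ (spanLast (_≟ d) P))

parent : List ℕ → List ℕ × ℕ
parent y = removeMax (maxL y) (takeWhile (_≢? maxL y) y) (drop 1 (dropWhile (_≢? maxL y) y))

indicator : Bool → ℕ
indicator b = if b then 1 else 0

ascentsAfter : ℕ → List ℕ → ℕ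
ascentsAfter q []      = 0
ascentsAfter q (b ∷ w) = indicator (q <ᵇ b) + ascentsAfter b w

ascents≡ascentsAfter : ∀ a w → ascents (a ∷ w) ≡ ascentsAfter a w
ascents≡ascentsAfter a []      = refl
ascents≡ascentsAfter a (b ∷ w) = cong (_ +_) (ascents≡ascentsAfter b w)

ascentsAfter-++ : ∀ q u w → ascentsAfter q (u ++ w) ≡ ascentsAfter q u + ascentsAfter (lastOr q u) w
ascentsAfter-++ q []      w = refl
ascentsAfter-++ q (b ∷ u) w rewrite ascentsAfter-++ b u w = sym (+-assoc (indicator (q <ᵇ b)) _ _)

ascentsAfter-up : ∀ {q b} w → q < b → ascentsAfter q (b ∷ w) ≡ suc (ascentsAfter b w)
ascentsAfter-up w q<b rewrite <ᵇ-true q<b = refl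

ascentsAfter-down : ∀ {q b} w → b ≤ q → ascentsAfter q (b ∷ w) ≡ ascentsAfter b w
ascentsAfter-down w b≤q rewrite <ᵇ-false b≤q = refl

ascentsAfter-plateau : ∀ {q vs} w → All (_≡ q) vs → ascentsAfter q (vs ++ w) ≡ ascentsAfter q w
ascentsAfter-plateau w [] = refl
ascentsAfter-plateau {q} {_ ∷ vs} w (refl ∷ vs≡q) = trans (ascentsAfter-down (vs ++ w) (≤-refl {q})) (ascentsAfter-plateau w vs≡q)

-- ascentsAfter 0 counts the first letter of a word of positive letters as an ascent top.
ascentsAfter0 : ∀ x → Good x → x ≢ [] → ascentsAfter 0 x ≡ suc (ascents x)
ascentsAfter0 []      _                   x≢[] = ⊥-elim (x≢[] refl)
ascentsAfter0 (a ∷ w) ((0<a ∷ _ , _) , _) _    = trans (ascentsAfter-up w 0<a) (cong suc (sym (ascents≡ascentsAfter a w)))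

WeakDescentAfter : ℕ → List ℕ → Set
WeakDescentAfter q []      = ⊤
WeakDescentAfter q (v ∷ _) = v ≤ q

marksFrom-∈⁻ : ∀ {k} i q w → k ∈ marksFrom i q w →
               ∃[ A ] ∃[ R ] w ≡ A ++ R × i + length A ≡ k × WeakDescentAfter (lastOr q A) R
marksFrom-∈⁻ i q []      (here refl) = [] , [] , refl , +-identityʳ i , tt
marksFrom-∈⁻ i q (v ∷ w) k∈ with v ≤? q
marksFrom-∈⁻ i q (v ∷ w) (here refl) | yes v≤q = [] , v ∷ w , refl , +-identityʳ i , v≤q
marksFrom-∈⁻ i q (v ∷ w) (there k∈)  | yes _ with marksFrom-∈⁻ (suc i) v w k∈
... | A , R , refl , refl , wd = v ∷ A , R , refl , +-suc i (length A) , wd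
marksFrom-∈⁻ i q (v ∷ w) k∈          | no _ with marksFrom-∈⁻ (suc i) v w k∈
... | A , R , refl , refl , wd = v ∷ A , R , refl , +-suc i (length A) , wd

marksFrom-∈⁺ : ∀ i q A R → WeakDescentAfter (lastOr q A) R → i + length A ∈ marksFrom i q (A ++ R)
marksFrom-∈⁺ i q []      []      _   rewrite +-identityʳ i = here refl
marksFrom-∈⁺ i q []      (v ∷ R) v≤q rewrite +-identityʳ i with v ≤? q
... | yes _   = here refl
... | no  v≰q = ⊥-elim (v≰q v≤q)
marksFrom-∈⁺ i q (a ∷ A) R wd rewrite +-suc i (length A) with a ≤? q
... | yes _ = there (marksFrom-∈⁺ (suc i) a A R wd)
... | no  _ = marksFrom-∈⁺ (suc i) a A R wd

MarkSplit : List ℕ → ℕ → Set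
MarkSplit x k = ∃[ A ] ∃[ R ] x ≡ A ++ R × length A ≡ k × A ≢ [] × WeakDescentAfter (lastOr 0 A) R

marks-∈⁻ : ∀ x p → suc p ∈ marks x → MarkSplit x (suc p)
marks-∈⁻ (a ∷ w) p (there p∈) with marksFrom-∈⁻ 1 a w p∈
... | A , R , refl , len , wd = a ∷ A , R , refl , len , (λ ()) , wd

marks-∈⁺ : ∀ x k → MarkSplit x k → k ∈ marks x
marks-∈⁺ x k ([]    , R , _    , _    , A≢[] , _)  = ⊥-elim (A≢[] refl)
marks-∈⁺ x k (a ∷ A , R , refl , refl , _    , wd) = there (marksFrom-∈⁺ 1 a A R wd)

removeMax-duplicate : ∀ M P R → removeMax M P (M ∷ R) ≡ (P ++ M ∷ R , 0)
removeMax-duplicate M P R with M ≟ M | M ≤? lastOr 0 P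
... | yes _  | _ = refl
... | no M≢M | _ = ⊥-elim (M≢M refl)

removeMax-keep : ∀ M P d R → d ≢ M → d ≤ lastOr 0 P → removeMax M P (d ∷ R) ≡ (P ++ d ∷ R , length P)
removeMax-keep M P d R d≢M d≤last with d ≟ M | d ≤? lastOr 0 P
... | yes d≡M | _       = ⊥-elim (d≢M d≡M)
... | no  _   | yes _   = refl
... | no  _   | no d≰ = ⊥-elim (d≰ d≤last)

removeMax-move : ∀ M P d R → d ≢ M → lastOr 0 P < d → removeMax M P (d ∷ R) ≡
  (proj₁ (spanLast (_≟ d) P) ++ d ∷ takeWhile (_≟ d) R ++ proj₂ (spanLast (_≟ d) P) ++ dropWhile (_≟ d) R
  , length (proj₁ (spanLast (_≟ d) P)))
removeMax-move M P d R d≢M last<d with d ≟ M | d ≤? lastOr 0 P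
... | yes d≡M | _       = ⊥-elim (d≢M d≡M)
... | no  _   | yes d≤  = ⊥-elim (<⇒≱ last<d d≤)
... | no  _   | no  _   = refl

parent-split : ∀ P M R → M ∉ P → maxL (P ++ M ∷ R) ≡ M → parent (P ++ M ∷ R) ≡ removeMax M P R
parent-split P M R M∉P max≡M rewrite max≡M | takeWhile-≢-first P {R} M∉P | dropWhile-≢-first P {R} M∉P = refl

gain : ℕ → ℕ
gain zero    = 0
gain (suc _) = 1

gain-length : ∀ (A : List ℕ) → A ≢ [] → gain (length A) ≡ 1
gain-length []      A≢[] = ⊥-elim (A≢[] refl)
gain-length (_ ∷ _) _    = refl

record IsChild (x : List ℕ) (p : ℕ) (y : List ℕ) : Set where
  field
    good     : Good y
    parent≡  : parent y ≡ (x , p)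
    ascents≡ : ascentsAfter 0 y ≡ gain p + ascentsAfter 0 x
    length≡  : length y ≡ suc (length x)
    letters  : ∀ {u} → u ∈ y → u ∈ x ⊎ u ≡ newMax x

length-insert : ∀ (u : List ℕ) {b} w → length (u ++ b ∷ w) ≡ suc (length (u ++ w))
length-insert u w = trans (length-++ u) (trans (+-suc (length u) (length w)) (cong suc (sym (length-++ u))))

NewAtTops-stutter⁺ : ∀ {S q m R} → NewAtTops S q (m ∷ R) → NewAtTops S q (m ∷ m ∷ R)
NewAtTops-stutter⁺ (new m∉ q<m n) = new m∉ q<m (NewAtTops-plateau⁺ (refl ∷ []) (here refl) n)
NewAtTops-stutter⁺ (old m∈ m≤q n) = old m∈ m≤q (NewAtTops-plateau⁺ (refl ∷ []) (here refl) n)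

NewAtTops-stutter⁻ : ∀ {S q m R} → NewAtTops S q (m ∷ m ∷ R) → NewAtTops S q (m ∷ R)
NewAtTops-stutter⁻ (new m∉ q<m n) = new m∉ q<m (NewAtTops-plateau⁻ (refl ∷ []) (here refl) n)
NewAtTops-stutter⁻ (old m∈ m≤q n) = old m∈ m≤q (NewAtTops-plateau⁻ (refl ∷ []) (here refl) n)

AboveFloor-stutter⁺ : ∀ {q d m R} → AboveFloor q d (m ∷ R) → AboveFloor q d (m ∷ m ∷ R)
AboveFloor-stutter⁺ (up q≤m f)         = up q≤m (AboveFloor-plateau⁺ (refl ∷ []) f)
AboveFloor-stutter⁺ (down m<q d≤m f)   = down m<q d≤m (AboveFloor-plateau⁺ (refl ∷ []) f)

AboveFloor-stutter⁻ : ∀ {q d m R} → AboveFloor q d (m ∷ m ∷ R) → AboveFloor q d (m ∷ R)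
AboveFloor-stutter⁻ (up q≤m f)         = up q≤m (AboveFloor-plateau⁻ (refl ∷ []) f)
AboveFloor-stutter⁻ (down m<q d≤m f)   = down m<q d≤m (AboveFloor-plateau⁻ (refl ∷ []) f)

∈-stutter⁺ : ∀ P {m : ℕ} {R} → P ++ m ∷ R ⊆ P ++ m ∷ m ∷ R
∈-stutter⁺ P u∈ with ∈-++⁻ P u∈
... | inj₁ u∈P = ∈-++⁺ˡ u∈P
... | inj₂ u∈R = ∈-++⁺ʳ P (there u∈R)

∈-stutter⁻ : ∀ P {m : ℕ} {R} → P ++ m ∷ m ∷ R ⊆ P ++ m ∷ R
∈-stutter⁻ P u∈ with ∈-++⁻ P u∈
... | inj₁ u∈P         = ∈-++⁺ˡ u∈P
... | inj₂ (here refl) = ∈-++⁺ʳ P (here refl)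
... | inj₂ (there u∈R) = ∈-++⁺ʳ P u∈R

Good-stutter⁺ : ∀ P {m R} → Good (P ++ m ∷ R) → Good (P ++ m ∷ m ∷ R)
Good-stutter⁺ P (cay , n , f) =
  Cayley-sameLetters _ _ (∈-stutter⁺ P) (∈-stutter⁻ P) cay ,
  (let nP , nR = NewAtTops-++⁻ P n in NewAtTops-++⁺ P nP (NewAtTops-stutter⁺ nR)) ,
  (let fP , fR = AboveFloor-++⁻ P f in AboveFloor-++⁺ P fP (AboveFloor-stutter⁺ fR))

Good-stutter⁻ : ∀ P {m R} → Good (P ++ m ∷ m ∷ R) → Good (P ++ m ∷ R)
Good-stutter⁻ P (cay , n , f) =
  Cayley-sameLetters _ _ (∈-stutter⁻ P) (∈-stutter⁺ P) cay ,
  (let nP , nR = NewAtTops-++⁻ P n in NewAtTops-++⁺ P nP (NewAtTops-stutter⁻ nR)) ,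
  (let fP , fR = AboveFloor-++⁻ P f in AboveFloor-++⁺ P fP (AboveFloor-stutter⁻ fR))

maxL-stutter : ∀ P {m R} → maxL (P ++ m ∷ m ∷ R) ≡ maxL (P ++ m ∷ R)
maxL-stutter P = ≤-antisym (maxL-mono _ _ (∈-stutter⁻ P)) (maxL-mono _ _ (∈-stutter⁺ P))

0<maxL : ∀ x → Good x → x ≢ [] → 0 < maxL x
0<maxL []      _                   x≢[] = ⊥-elim (x≢[] refl)
0<maxL (a ∷ x) ((0<a ∷ _ , _) , _) _    = ≤-trans 0<a (∈⇒≤maxL (a ∷ x) (here refl))

<newMax : ∀ x → All (_< newMax x) x
<newMax x = tabulate (s≤s ∘ ∈⇒≤maxL x)

duplicate-IsChild : ∀ P M R → Good (P ++ M ∷ R) → maxL (P ++ M ∷ R) ≡ M → M ∉ P →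
                    IsChild (P ++ M ∷ R) 0 (P ++ M ∷ M ∷ R)
duplicate-IsChild P M R g max≡M M∉P = record
  { good     = Good-stutter⁺ P g
  ; parent≡  = trans (parent-split P M (M ∷ R) M∉P (trans (maxL-stutter P) max≡M)) (removeMax-duplicate M P R)
  ; ascents≡ = ascents≡
  ; length≡  = length-insert P (M ∷ R)
  ; letters  = inj₁ ∘ ∈-stutter⁻ P
  }
  where
  ascents≡ : ascentsAfter 0 (P ++ M ∷ M ∷ R) ≡ 0 + ascentsAfter 0 (P ++ M ∷ R)
  ascents≡ rewrite ascentsAfter-++ 0 P (M ∷ M ∷ R) | ascentsAfter-++ 0 P (M ∷ R) | <ᵇ-false (≤-refl {M}) = refl

duplicateMax-split : ∀ P M R → M ∉ P → maxL (P ++ M ∷ R) ≡ M → duplicateMax (P ++ M ∷ R) ≡ P ++ M ∷ M ∷ R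
duplicateMax-split P M R M∉P max≡M rewrite max≡M | takeWhile-≢-first P {R} M∉P | dropWhile-≢-first P {R} M∉P = refl

duplicateMax-IsChild : ∀ x → Good x → x ≢ [] → IsChild x 0 (duplicateMax x)
duplicateMax-IsChild x g x≢[] with ∈⇒first (maxL∈ x (0<maxL x g x≢[]))
... | P , R , x≡ , M∉P = subst (λ z → IsChild z 0 (duplicateMax z)) (sym x≡) child-of-split
  where
  M = maxL x
  max≡M : maxL (P ++ M ∷ R) ≡ M
  max≡M = cong maxL (sym x≡)
  child-of-split : IsChild (P ++ M ∷ R) 0 (duplicateMax (P ++ M ∷ R))
  child-of-split rewrite duplicateMax-split P M R M∉P max≡M = duplicate-IsChild P M R (subst Good x≡ g) max≡M M∉P

append-IsChild : ∀ a w → let x = a ∷ w in Good x → IsChild x (length x) (x ++ [ newMax x ])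
append-IsChild a w (cay , n , f) = record
  { good     = proj₁ cayley , NewAtTops-++⁺ x n (new (M∉x ∘ ∈-reverseAcc[] x) last<M []) , AboveFloor-++⁺ x f (up (<⇒≤ last<M) [])
  ; parent≡  = parent-split x M [] M∉x (proj₂ cayley)
  ; ascents≡ = ascents≡
  ; length≡  = ↭-length y↭
  ; letters  = ↭-letters y↭
  }
  where
  x = a ∷ w
  M = newMax x
  y↭ : x ++ [ M ] ↭ M ∷ x
  y↭ = ↭-sym (∷↭∷ʳ M x)
  cayley : Cayley (x ++ [ M ]) × maxL (x ++ [ M ]) ≡ M
  cayley = Cayley-↭-add y↭ cay
  M∉x : M ∉ x
  M∉x M∈x = <-irrefl refl (lookup (<newMax x) M∈x)
  last<M : lastOr 0 x < M
  last<M = lastOr-All 0 x (s≤s z≤n) (<newMax x)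
  ascents≡ : ascentsAfter 0 (x ++ [ M ]) ≡ 1 + ascentsAfter 0 x
  ascents≡ rewrite ascentsAfter-++ 0 x [ M ] | <ᵇ-true last<M = +-comm (ascentsAfter 0 x) 1

NewAtTops-extend : ∀ {S p a w} → a ∉ w → NewAtTops S p w → NewAtTops (a ∷ S) p w
NewAtTops-extend a∉w = NewAtTops-resp (λ b∈w → there , λ { (here refl) → ⊥-elim (a∉w b∈w) ; (there b∈S) → b∈S })

-- A first letter above the previous one is new, so it stays an ascent top after any smaller letter.
NewAtTops-reprev : ∀ {S p p′ w} → Maybe.All (p <_) (head w) → Maybe.All (p′ <_) (head w) → NewAtTops S p w → NewAtTops S p′ w
NewAtTops-reprev _          _           []            = []
NewAtTops-reprev _          (just p′<b) (new b∉S _ n) = new b∉S p′<b n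
NewAtTops-reprev (just p<b) _           (old _ b≤p _) = ⊥-elim (<⇒≱ p<b b≤p)

NewAtTops-head≢ : ∀ {S q v w} → q < v → All (v ≤_) w → v ∈ S → NewAtTops S q w → Maybe.All (_≢ v) (head w)
NewAtTops-head≢ q<v _         v∈S []            = nothing
NewAtTops-head≢ q<v _         v∈S (new b∉S _ _) = just λ { refl → b∉S v∈S }
NewAtTops-head≢ q<v (v≤b ∷ _) v∈S (old _ b≤q _) = ⊥-elim (<⇒≱ (<-≤-trans q<v v≤b) b≤q)

head-above : ∀ {q v w} → q ≤ v → All (v ≤_) w → Maybe.All (_≢ v) (head w) → Maybe.All (q <_) (head w)
head-above q≤v []        nothing    = nothing
head-above q≤v (v≤b ∷ _) (just b≢v) = just (≤-<-trans q≤v (≤∧≢⇒< v≤b (≢-sym b≢v)))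

ascentsAfter-reprev : ∀ {q q′} w → Maybe.All (q <_) (head w) → Maybe.All (q′ <_) (head w) → ascentsAfter q w ≡ ascentsAfter q′ w
ascentsAfter-reprev []      _          _           = refl
ascentsAfter-reprev (b ∷ w) (just q<b) (just q′<b) = trans (ascentsAfter-up w q<b) (sym (ascentsAfter-up w q′<b))

ascentsAfter-peak : ∀ {q M v} U w → lastOr q U < M → v < M → ascentsAfter q (U ++ M ∷ v ∷ w) ≡ ascentsAfter q U + suc (ascentsAfter v w)
ascentsAfter-peak {q} {M} {v} U w last<M v<M = begin
  ascentsAfter q (U ++ M ∷ v ∷ w)                 ≡⟨ ascentsAfter-++ q U _ ⟩
  ascentsAfter q U + ascentsAfter (lastOr q U) (M ∷ v ∷ w) ≡⟨ cong (ascentsAfter q U +_) (ascentsAfter-up (v ∷ w) last<M) ⟩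
  ascentsAfter q U + suc (ascentsAfter M (v ∷ w)) ≡⟨ cong (λ k → ascentsAfter q U + suc k) (ascentsAfter-down w (<⇒≤ v<M)) ⟩
  ascentsAfter q U + suc (ascentsAfter v w)       ∎
  where open ≡-Reasoning

LastSatisfies-of : ∀ {P : ℕ → Set} q B → B ≢ [] → P (lastOr q B) → LastSatisfies P B
LastSatisfies-of q []      B≢[] _  = ⊥-elim (B≢[] refl)
LastSatisfies-of q (b ∷ B) _    Pℓ = Pℓ

-- After a change of letter, a reappearing letter a bounds everything after it from below.
∉-ending-below : ∀ {S p d a} B {C} → a ∈ S → Maybe.All (_≢ a) (head (B ++ C)) →
                 NewAtTops S p (B ++ C) → AboveFloor p d (B ++ C) → lastOr p B < a → a ∉ B
∉-ending-below (c ∷ B) a∈S (just c≢a) n f last<a (here a≡c)  = c≢a (sym a≡c)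
∉-ending-below {a = a} (c ∷ B) {C} a∈S (just c≢a) n f last<a (there a∈B) with ∈-∃++ a∈B
... | C₁ , C₂ , refl = <⇒≱ (subst (_< a) (lastOr-++ c C₁ (a ∷ C₂)) last<a) (lastOr-All a C₂ ≤-refl (All.++⁻ˡ C₂ a≤))
  where
  a≤ : All (a ≤_) (C₂ ++ C)
  a≤ = above-later-repeat C₁ (there a∈S) (≢-sym c≢a)
         (subst (NewAtTops _ c) (++-assoc C₁ (a ∷ C₂) C) (NewAtTops-tail n))
         (subst (AboveFloor c _) (++-assoc C₁ (a ∷ C₂) C) (AboveFloor-tail f))

LastSatisfies-lastOr : ∀ {P : ℕ → Set} q B → B ≢ [] → LastSatisfies P B → P (lastOr q B)
LastSatisfies-lastOr q []      B≢[] _  = ⊥-elim (B≢[] refl)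
LastSatisfies-lastOr q (b ∷ B) _    Pℓ = Pℓ

insert↭ : ∀ (A B₁ C B₂ : List ℕ) M → A ++ B₁ ++ M ∷ C ++ B₂ ↭ M ∷ A ++ C ++ B₁ ++ B₂
insert↭ A B₁ C B₂ M = ↭-trans (↭-reflexive (sym (++-assoc A B₁ _)))
                     (↭-trans (shift M (A ++ B₁) (C ++ B₂))
                     (prep M (↭-trans (↭-reflexive (++-assoc A B₁ _)) (++⁺ˡ A (shifts B₁ C)))))

module Insertion (A : List ℕ) (v : ℕ) (vs B₁ B₂ : List ℕ) (g : Good (A ++ v ∷ vs ++ B₁ ++ B₂))
                 (v≤ℓ : v ≤ lastOr 0 A) (vs≡v : All (_≡ v) vs) (v≤B₂ : All (v ≤_) B₂) where

  x = A ++ v ∷ vs ++ B₁ ++ B₂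
  M = newMax x
  y = A ++ B₁ ++ M ∷ v ∷ vs ++ B₂
  Sᴬ = reverseAcc [] A
  ℓ = lastOr 0 A
  d = floorAfter 0 0 A

  nA : NewAtTops [] 0 A
  nA = proj₁ (NewAtTops-++⁻ A (proj₁ (proj₂ g)))

  nW : NewAtTops Sᴬ ℓ (v ∷ vs ++ B₁ ++ B₂)
  nW = proj₂ (NewAtTops-++⁻ A (proj₁ (proj₂ g)))

  fA : AboveFloor 0 0 A
  fA = proj₁ (AboveFloor-++⁻ A (proj₂ (proj₂ g)))

  fW : AboveFloor ℓ d (v ∷ vs ++ B₁ ++ B₂)
  fW = proj₂ (AboveFloor-++⁻ A (proj₂ (proj₂ g)))

  v∈S : v ∈ Sᴬ
  v∈S with nW
  ... | new _ ℓ<v _ = ⊥-elim (<⇒≱ ℓ<v v≤ℓ)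
  ... | old v∈S _ _ = v∈S

  nB : NewAtTops Sᴬ v (B₁ ++ B₂)
  nB = NewAtTops-absorb v∈S (NewAtTops-plateau⁻ vs≡v (here refl) (NewAtTops-tail nW))

  d≤v : d ≤ v
  d≤v with fW
  ... | up ℓ≤v _     = ≤-trans (floorAfter≤lastOr z≤n fA) ℓ≤v
  ... | down _ d≤v _ = d≤v

  floorB : (ℓ ≡ v × AboveFloor v d (B₁ ++ B₂)) ⊎ AboveFloor v v (B₁ ++ B₂)
  floorB with fW
  ... | up ℓ≤v f     = inj₁ (≤-antisym ℓ≤v v≤ℓ , AboveFloor-plateau⁻ vs≡v f)
  ... | down _ _ f   = inj₂ (AboveFloor-plateau⁻ vs≡v f)

  fB₂ : ∃[ d′ ] AboveFloor (lastOr v B₁) d′ B₂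
  fB₂ with floorB
  ... | inj₁ (_ , f) = _ , proj₂ (AboveFloor-++⁻ B₁ f)
  ... | inj₂ f       = _ , proj₂ (AboveFloor-++⁻ B₁ f)

  x<M : All (_< M) x
  x<M = <newMax x

  v<M : v < M
  v<M = lookup x<M (∈-++⁺ʳ A (here refl))

  ℓ<M : ℓ < M
  ℓ<M = lastOr-All 0 A (≤-<-trans z≤n v<M) (All.++⁻ˡ A x<M)

  B₁<M : All (_< M) B₁
  B₁<M = All.++⁻ˡ B₁ (All.++⁻ʳ vs (All.tail (All.++⁻ʳ A x<M)))

  M∉ : ∀ {w} → All (_< M) w → M ∉ w
  M∉ w<M M∈w = <-irrefl refl (lookup w<M M∈w)

  M∉A : M ∉ A
  M∉A = M∉ (All.++⁻ˡ A x<M)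

  M∉B₂ : M ∉ B₂
  M∉B₂ = M∉ (All.++⁻ʳ B₁ (All.++⁻ʳ vs (All.tail (All.++⁻ʳ A x<M))))

  M∉AB₁ : M ∉ A ++ B₁
  M∉AB₁ = M∉ (All.++⁺ (All.++⁻ˡ A x<M) B₁<M)

  M∉S₁ : M ∉ reverseAcc Sᴬ B₁
  M∉S₁ M∈ with ∈-reverseAcc⁻ Sᴬ B₁ M∈
  ... | inj₁ M∈S  = M∉ (All.++⁻ˡ A x<M) (∈-reverseAcc[] A M∈S)
  ... | inj₂ M∈B₁ = M∉ B₁<M M∈B₁

  y↭ : y ↭ M ∷ x
  y↭ = insert↭ A B₁ (v ∷ vs) B₂ M

  letters : ∀ {u} → u ∈ y → u ∈ x ⊎ u ≡ M
  letters = ↭-letters y↭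

  cayley : Cayley y × maxL y ≡ M
  cayley = Cayley-↭-add y↭ (proj₁ g)

  length≡ : length y ≡ suc (length x)
  length≡ = ↭-length y↭

  ascents-x : ascentsAfter 0 x ≡ ascentsAfter 0 A + ascentsAfter v (B₁ ++ B₂)
  ascents-x = begin
    ascentsAfter 0 (A ++ v ∷ vs ++ B₁ ++ B₂)       ≡⟨ ascentsAfter-++ 0 A _ ⟩
    ascentsAfter 0 A + ascentsAfter ℓ (v ∷ vs ++ B₁ ++ B₂) ≡⟨ cong (ascentsAfter 0 A +_) (ascentsAfter-down (vs ++ B₁ ++ B₂) v≤ℓ) ⟩
    ascentsAfter 0 A + ascentsAfter v (vs ++ B₁ ++ B₂) ≡⟨ cong (ascentsAfter 0 A +_) (ascentsAfter-plateau (B₁ ++ B₂) vs≡v) ⟩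
    ascentsAfter 0 A + ascentsAfter v (B₁ ++ B₂)   ∎
    where open ≡-Reasoning

insertDirect-IsChild : ∀ A v vs B₂ → Good (A ++ v ∷ vs ++ B₂) → v ≤ lastOr 0 A → All (_≡ v) vs → All (v ≤_) B₂ →
                       A ≢ [] → IsChild (A ++ v ∷ vs ++ B₂) (length A) (A ++ newMax (A ++ v ∷ vs ++ B₂) ∷ v ∷ vs ++ B₂)
insertDirect-IsChild A v vs B₂ g v≤ℓ vs≡v v≤B₂ A≢[] = record
  { good     = proj₁ cayley , tops , floors
  ; parent≡  = trans (parent-split A M (v ∷ vs ++ B₂) M∉A (proj₂ cayley)) (removeMax-keep M A v (vs ++ B₂) (<⇒≢ v<M) v≤ℓ)
  ; ascents≡ = ascents≡
  ; length≡  = length≡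
  ; letters  = letters
  }
  where
  open Insertion A v vs [] B₂ g v≤ℓ vs≡v v≤B₂
  tops : NewAtTops [] 0 y
  tops = NewAtTops-++⁺ A nA (new (M∉A ∘ ∈-reverseAcc[] A) ℓ<M (old (there v∈S) (<⇒≤ v<M)
           (NewAtTops-plateau⁺ vs≡v (here refl) (NewAtTops-repeat (there v∈S) (NewAtTops-extend M∉B₂ nB)))))
  floors : AboveFloor 0 0 y
  floors = AboveFloor-++⁺ A fA (up (<⇒≤ ℓ<M) (down v<M d≤v (AboveFloor-plateau⁺ vs≡v (AboveFloor-restart (All⇒head v≤B₂) v≤B₂ (proj₂ fB₂)))))
  ascents≡ : ascentsAfter 0 y ≡ gain (length A) + ascentsAfter 0 x
  ascents≡ = begin
    ascentsAfter 0 (A ++ M ∷ v ∷ vs ++ B₂)          ≡⟨ ascentsAfter-peak A (vs ++ B₂) ℓ<M v<M ⟩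
    ascentsAfter 0 A + suc (ascentsAfter v (vs ++ B₂)) ≡⟨ +-suc _ _ ⟩
    suc (ascentsAfter 0 A + ascentsAfter v (vs ++ B₂)) ≡⟨ cong (λ k → suc (ascentsAfter 0 A + k)) (ascentsAfter-plateau B₂ vs≡v) ⟩
    suc (ascentsAfter 0 A + ascentsAfter v B₂)      ≡⟨ cong suc (sym ascents-x) ⟩
    1 + ascentsAfter 0 x                            ≡⟨ cong (_+ ascentsAfter 0 x) (sym (gain-length A A≢[])) ⟩
    gain (length A) + ascentsAfter 0 x              ∎
    where open ≡-Reasoning

module MovedInsertion (A : List ℕ) (v : ℕ) (vs B₁ B₂ : List ℕ) (g : Good (A ++ v ∷ vs ++ B₁ ++ B₂))
                      (v≤ℓ : v ≤ lastOr 0 A) (vs≡v : All (_≡ v) vs) (v≤B₂ : All (v ≤_) B₂) (A≢[] : A ≢ []) (B₁≢[] : B₁ ≢ [])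
                      (B₁<v : LastSatisfies (_< v) B₁) (head≢v : Maybe.All (_≢ v) (head (B₁ ++ B₂))) where

  open Insertion A v vs B₁ B₂ g v≤ℓ vs≡v v≤B₂ public

  last<v : lastOr v B₁ < v
  last<v = LastSatisfies-lastOr v B₁ B₁≢[] B₁<v
  -- v continues a plateau ending A, since otherwise everything after v,
  -- including the last letter of B₁, would be at least v.
  fB : ℓ ≡ v × AboveFloor v d (B₁ ++ B₂)
  fB with floorB
  ... | inj₁ ℓ≡v,f = ℓ≡v,f
  ... | inj₂ f     = ⊥-elim (<⇒≱ last<v (lastOr-All v B₁ ≤-refl (All.++⁻ˡ B₁ (AboveFloor-lower ≤-refl f))))
  ℓ≡v : ℓ ≡ v
  ℓ≡v = proj₁ fB
  nB₁ : NewAtTops Sᴬ v B₁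
  nB₁ = proj₁ (NewAtTops-++⁻ B₁ nB)
  nB₂ : NewAtTops (reverseAcc Sᴬ B₁) (lastOr v B₁) B₂
  nB₂ = proj₂ (NewAtTops-++⁻ B₁ nB)
  fB₁ : AboveFloor v d B₁
  fB₁ = proj₁ (AboveFloor-++⁻ B₁ (proj₂ fB))
  v∈S₁ : v ∈ reverseAcc Sᴬ B₁
  v∈S₁ = ∈-reverseAccˡ Sᴬ B₁ v∈S
  last<M : lastOr v B₁ < M
  last<M = <-trans last<v v<M
  last≡ : lastOr 0 (A ++ B₁) ≡ lastOr v B₁
  last≡ = trans (lastOr-++ 0 A B₁) (cong (λ p → lastOr p B₁) ℓ≡v)
  v∉B₁ : v ∉ B₁
  v∉B₁ = ∉-ending-below B₁ v∈S head≢v nB (proj₂ fB) last<v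
  nsB₂ : Maybe.All (_≢ v) (head B₂)
  nsB₂ = NewAtTops-head≢ last<v v≤B₂ v∈S₁ nB₂
  tops : NewAtTops [] 0 y
  tops = NewAtTops-++⁺ A nA (subst (λ p → NewAtTops Sᴬ p (B₁ ++ M ∷ v ∷ vs ++ B₂)) (sym ℓ≡v)
           (NewAtTops-++⁺ B₁ nB₁ (new M∉S₁ last<M (old (there v∈S₁) (<⇒≤ v<M)
             (NewAtTops-plateau⁺ vs≡v (here refl) (NewAtTops-repeat (there v∈S₁)
               (NewAtTops-extend M∉B₂ (NewAtTops-reprev (head-above (<⇒≤ last<v) v≤B₂ nsB₂) (head-above ≤-refl v≤B₂ nsB₂) nB₂))))))))
  floors : AboveFloor 0 0 y
  floors = AboveFloor-++⁺ A fA (subst (λ p → AboveFloor p d (B₁ ++ M ∷ v ∷ vs ++ B₂)) (sym ℓ≡v)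
             (AboveFloor-++⁺ B₁ fB₁ (up (<⇒≤ last<M) (down v<M (<⇒≤ (≤-<-trans (floorAfter≤lastOr d≤v fB₁) last<v))
               (AboveFloor-plateau⁺ vs≡v (AboveFloor-restart (All⇒head v≤B₂) v≤B₂ (proj₂ fB₂)))))))
  parent≡ : parent y ≡ (x , length A)
  parent≡ rewrite sym (++-assoc A B₁ (M ∷ v ∷ vs ++ B₂))
                | parent-split (A ++ B₁) M (v ∷ vs ++ B₂) M∉AB₁ (trans (cong maxL (++-assoc A B₁ _)) (proj₂ cayley))
                | removeMax-move M (A ++ B₁) v (vs ++ B₂) (<⇒≢ v<M) (subst (_< v) (sym last≡) last<v)
                | spanLast-char (_≟ v) A {B₁} (LastSatisfies-of 0 A A≢[] ℓ≡v) (tabulate λ { b∈ refl → v∉B₁ b∈ })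
                | takeWhile-++ (_≟ v) vs {B₂} vs≡v nsB₂ | dropWhile-++ (_≟ v) vs {B₂} vs≡v nsB₂
                = refl
  ascents≡ : ascentsAfter 0 y ≡ gain (length A) + ascentsAfter 0 x
  ascents≡ = begin
    ascentsAfter 0 y                                                   ≡⟨ cong (ascentsAfter 0) (sym (++-assoc A B₁ _)) ⟩
    ascentsAfter 0 ((A ++ B₁) ++ M ∷ v ∷ vs ++ B₂)                     ≡⟨ ascentsAfter-peak (A ++ B₁) (vs ++ B₂) (subst (_< M) (sym last≡) last<M) v<M ⟩
    ascentsAfter 0 (A ++ B₁) + suc (ascentsAfter v (vs ++ B₂))         ≡⟨ cong₂ (λ a b → a + suc b) (ascentsAfter-++ 0 A B₁) (ascentsAfter-plateau B₂ vs≡v) ⟩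
    (ascentsAfter 0 A + ascentsAfter ℓ B₁) + suc (ascentsAfter v B₂)   ≡⟨ cong (λ p → (ascentsAfter 0 A + ascentsAfter p B₁) + suc (ascentsAfter v B₂)) ℓ≡v ⟩
    (ascentsAfter 0 A + ascentsAfter v B₁) + suc (ascentsAfter v B₂)   ≡⟨ +-suc _ _ ⟩
    suc ((ascentsAfter 0 A + ascentsAfter v B₁) + ascentsAfter v B₂)   ≡⟨ cong suc (+-assoc (ascentsAfter 0 A) (ascentsAfter v B₁) (ascentsAfter v B₂)) ⟩
    suc (ascentsAfter 0 A + (ascentsAfter v B₁ + ascentsAfter v B₂))   ≡⟨ cong (λ k → suc (ascentsAfter 0 A + (ascentsAfter v B₁ + k)))
                                                                              (ascentsAfter-reprev B₂ (head-above ≤-refl v≤B₂ nsB₂) (head-above (<⇒≤ last<v) v≤B₂ nsB₂)) ⟩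
    suc (ascentsAfter 0 A + (ascentsAfter v B₁ + ascentsAfter (lastOr v B₁) B₂)) ≡⟨ cong (λ k → suc (ascentsAfter 0 A + k)) (sym (ascentsAfter-++ v B₁ B₂)) ⟩
    suc (ascentsAfter 0 A + ascentsAfter v (B₁ ++ B₂))                 ≡⟨ cong suc (sym ascents-x) ⟩
    1 + ascentsAfter 0 x                                               ≡⟨ cong (_+ ascentsAfter 0 x) (sym (gain-length A A≢[])) ⟩
    gain (length A) + ascentsAfter 0 x                                 ∎
    where
    open ≡-Reasoning

insertMoved-IsChild : ∀ A v vs B₁ B₂ → Good (A ++ v ∷ vs ++ B₁ ++ B₂) → v ≤ lastOr 0 A → All (_≡ v) vs → All (v ≤_) B₂ →
                      A ≢ [] → B₁ ≢ [] → LastSatisfies (_< v) B₁ → Maybe.All (_≢ v) (head (B₁ ++ B₂)) →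
                      IsChild (A ++ v ∷ vs ++ B₁ ++ B₂) (length A) (A ++ B₁ ++ newMax (A ++ v ∷ vs ++ B₁ ++ B₂) ∷ v ∷ vs ++ B₂)
insertMoved-IsChild A v vs B₁ B₂ g v≤ℓ vs≡v v≤B₂ A≢[] B₁≢[] B₁<v head≢v = record
  { good     = proj₁ cayley , tops , floors
  ; parent≡  = parent≡
  ; ascents≡ = ascents≡
  ; length≡  = length≡
  ; letters  = letters
  }
  where open MovedInsertion A v vs B₁ B₂ g v≤ℓ vs≡v v≤B₂ A≢[] B₁≢[] B₁<v head≢v

insertNewMax-IsChild : ∀ A v R → Good (A ++ v ∷ R) → A ≢ [] → v ≤ lastOr 0 A →
  IsChild (A ++ v ∷ R) (length A)
    (A ++ proj₁ (spanLast (_<? v) (dropWhile (_≟ v) R)) ++ newMax (A ++ v ∷ R) ∷ v ∷ takeWhile (_≟ v) R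
       ++ proj₂ (spanLast (_<? v) (dropWhile (_≟ v) R)))
insertNewMax-IsChild A v R g A≢[] v≤ℓ
  with takeWhile (_≟ v) R | dropWhile (_≟ v) R | takeWhile++dropWhile (_≟ v) R | all-takeWhile (_≟ v) R | all-head-dropWhile (_≟ v) R
... | vs | B | refl | vs≡v | head≢v
  with spanLast (_<? v) B | spanLast-++ (_<? v) B | spanLast-last (_<? v) B | spanLast-rest (_<? v) B
... | []     , B₂ | refl | _    | B₂≮v = insertDirect-IsChild A v vs B₂ g v≤ℓ vs≡v (All.map ≮⇒≥ B₂≮v) A≢[]
... | b ∷ B₁ , B₂ | refl | B₁<v | B₂≮v =
  insertMoved-IsChild A v vs (b ∷ B₁) B₂ g v≤ℓ vs≡v (All.map ≮⇒≥ B₂≮v) A≢[] (λ ()) B₁<v head≢v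

take-length-++ : ∀ (A R : List ℕ) → take (length A) (A ++ R) ≡ A
take-length-++ []      R = refl
take-length-++ (a ∷ A) R = cong (a ∷_) (take-length-++ A R)

drop-length-++ : ∀ (A R : List ℕ) → drop (length A) (A ++ R) ≡ R
drop-length-++ []      R = refl
drop-length-++ (a ∷ A) R = drop-length-++ A R

child-split : ∀ a A R → child (a ∷ A ++ R) (length (a ∷ A)) ≡ insertNewMax (newMax (a ∷ A ++ R)) (a ∷ A) R
child-split a A R rewrite take-length-++ A R | drop-length-++ A R = refl

child-IsChild : ∀ x p → Good x → x ≢ [] → p ∈ marks x → IsChild x p (child x p)
child-IsChild x zero    g x≢[] _  = duplicateMax-IsChild x g x≢[]
child-IsChild x (suc p) g x≢[] p∈ with marks-∈⁻ x p p∈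
... | []    , R , _    , _   , A≢[] , _ = ⊥-elim (A≢[] refl)
... | a ∷ A , R , refl , len , _   , wd with suc-injective len
... | refl rewrite child-split a A R with R | wd
...   | []     | _   rewrite ++-identityʳ A = append-IsChild a A g
...   | v ∷ R′ | v≤ℓ = insertNewMax-IsChild (a ∷ A) v R′ g (λ ()) v≤ℓ

record IsParent (y x : List ℕ) (p : ℕ) : Set where
  field
    good     : Good x
    nonempty : x ≢ []
    mark     : p ∈ marks x
    child≡   : child x p ≡ y

module Removal (P : List ℕ) (M : ℕ) (R : List ℕ) (g : Good (P ++ M ∷ R)) (max≡M : maxL (P ++ M ∷ R) ≡ M) (M∉P : M ∉ P) where

  y = P ++ M ∷ R
  Sᴾ = reverseAcc [] P
  ℓ = lastOr 0 P
  dᴾ = floorAfter 0 0 P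

  nP : NewAtTops [] 0 P
  nP = proj₁ (NewAtTops-++⁻ P (proj₁ (proj₂ g)))

  nM : NewAtTops Sᴾ ℓ (M ∷ R)
  nM = proj₂ (NewAtTops-++⁻ P (proj₁ (proj₂ g)))

  fP : AboveFloor 0 0 P
  fP = proj₁ (AboveFloor-++⁻ P (proj₂ (proj₂ g)))

  fM : AboveFloor ℓ dᴾ (M ∷ R)
  fM = proj₂ (AboveFloor-++⁻ P (proj₂ (proj₂ g)))

  ℓ<M : ℓ < M
  ℓ<M with nM
  ... | new _ ℓ<M _  = ℓ<M
  ... | old M∈ _ _   = ⊥-elim (M∉P (∈-reverseAcc[] P M∈))

  nR : NewAtTops (M ∷ Sᴾ) M R
  nR = NewAtTops-tail nM

  fR : AboveFloor M dᴾ R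
  fR with fM
  ... | up _ f       = f
  ... | down M<ℓ _ _ = ⊥-elim (<⇒≱ M<ℓ (<⇒≤ ℓ<M))

  y≤M : All (_≤ M) y
  y≤M = tabulate (λ u∈y → subst (_ ≤_) max≡M (∈⇒≤maxL y u∈y))

  1≤M : 1 ≤ M
  1≤M = ≤-<-trans z≤n ℓ<M

child-last : ∀ x → x ≢ [] → child x (length x) ≡ x ++ [ newMax x ]
child-last []      x≢[] = ⊥-elim (x≢[] refl)
child-last (a ∷ w) _    rewrite take-all (length w) w ≤-refl | drop-all (length w) w ≤-refl = refl

removeLast-IsParent : ∀ P M → Good (P ++ [ M ]) → maxL (P ++ [ M ]) ≡ M → M ∉ P → P ≢ [] → IsParent (P ++ [ M ]) P (length P)
removeLast-IsParent P M g max≡M M∉P P≢[] = record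
  { good     = proj₁ cayley , nP , fP
  ; nonempty = P≢[]
  ; mark     = marks-∈⁺ P (length P) (P , [] , sym (++-identityʳ P) , refl , P≢[] , tt)
  ; child≡   = trans (child-last P P≢[]) (cong (λ m → P ++ [ m ]) (proj₂ cayley))
  }
  where
  open Removal P M [] g max≡M M∉P
  cayley : Cayley P × newMax P ≡ M
  cayley = Cayley-↭-remove (↭-sym (∷↭∷ʳ M P)) max≡M M∉P 1≤M (proj₁ g)

≢[] : ∀ (P : List ℕ) {M R} → P ++ M ∷ R ≢ []
≢[] []      ()
≢[] (_ ∷ _) ()

0∈marks : ∀ x → x ≢ [] → 0 ∈ marks x
0∈marks []      x≢[] = ⊥-elim (x≢[] refl)
0∈marks (_ ∷ _) _    = here refl

removeDuplicate-IsParent : ∀ P M R → Good (P ++ M ∷ M ∷ R) → maxL (P ++ M ∷ M ∷ R) ≡ M → M ∉ P →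
                           IsParent (P ++ M ∷ M ∷ R) (P ++ M ∷ R) 0
removeDuplicate-IsParent P M R g max≡M M∉P = record
  { good     = Good-stutter⁻ P g
  ; nonempty = ≢[] P
  ; mark     = 0∈marks _ (≢[] P)
  ; child≡   = duplicateMax-split P M R M∉P (trans (sym (maxL-stutter P)) max≡M)
  }

NewAtTops-forget : ∀ {S p a b w} → a ∉ w → NewAtTops (b ∷ a ∷ S) p w → NewAtTops (b ∷ S) p w
NewAtTops-forget a∉w = NewAtTops-resp (λ c∈w →
  (λ { (here refl) → here refl ; (there (here refl)) → ⊥-elim (a∉w c∈w) ; (there (there c∈S)) → there c∈S }) ,
  (λ { (here refl) → here refl ; (there c∈S) → there (there c∈S) }))

module Descent (P : List ℕ) (M d : ℕ) (R : List ℕ) (g : Good (P ++ M ∷ d ∷ R)) (max≡M : maxL (P ++ M ∷ d ∷ R) ≡ M)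
               (M∉P : M ∉ P) (d≢M : d ≢ M) where

  open Removal P M (d ∷ R) g max≡M M∉P public

  d<M : d < M
  d<M = ≤∧≢⇒< (lookup y≤M (∈-++⁺ʳ P (there (here refl)))) d≢M

  d∈Sᴾ : d ∈ Sᴾ
  d∈Sᴾ with nR
  ... | new _ M<d _         = ⊥-elim (<⇒≱ M<d (<⇒≤ d<M))
  ... | old (here d≡M) _ _  = ⊥-elim (d≢M d≡M)
  ... | old (there d∈) _ _  = d∈

  d∈P : d ∈ P
  d∈P = ∈-reverseAcc[] P d∈Sᴾ

  nR′ : NewAtTops (d ∷ M ∷ Sᴾ) d R
  nR′ = NewAtTops-tail nR

  dᴾ≤d : dᴾ ≤ d
  dᴾ≤d with fR
  ... | up M≤d _      = ⊥-elim (<⇒≱ d<M M≤d)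
  ... | down _ dᴾ≤d _ = dᴾ≤d

  fR′ : AboveFloor d d R
  fR′ with fR
  ... | up M≤d _   = ⊥-elim (<⇒≱ d<M M≤d)
  ... | down _ _ f = f

  d≤R : All (d ≤_) R
  d≤R = AboveFloor-lower ≤-refl fR′

  M∉R : M ∉ R
  M∉R = max-not-again (there (here refl)) d<M (All.tail (All.tail (All.++⁻ʳ P y≤M))) nR′

  M∉Pd : M ∉ P ++ d ∷ R
  M∉Pd M∈ with ∈-++⁻ P M∈
  ... | inj₁ M∈P          = M∉P M∈P
  ... | inj₂ (here M≡d)   = d≢M (sym M≡d)
  ... | inj₂ (there M∈R)  = M∉R M∈R

removeKeep-IsParent : ∀ P M d R → Good (P ++ M ∷ d ∷ R) → maxL (P ++ M ∷ d ∷ R) ≡ M → M ∉ P → d ≢ M → d ≤ lastOr 0 P →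
                      IsParent (P ++ M ∷ d ∷ R) (P ++ d ∷ R) (length P)
removeKeep-IsParent P M d R g max≡M M∉P d≢M d≤ℓ = record
  { good     = proj₁ cayley , tops , floors
  ; nonempty = ≢[] P
  ; mark     = marks-∈⁺ x (length P) (P , d ∷ R , refl , refl , P≢[] , d≤ℓ)
  ; child≡   = child≡ P refl P≢[]
  }
  where
  open Descent P M d R g max≡M M∉P d≢M
  x = P ++ d ∷ R
  P≢[] : P ≢ []
  P≢[] refl with d∈P
  ... | ()
  cayley : Cayley x × newMax x ≡ M
  cayley = Cayley-↭-remove (shift M P (d ∷ R)) max≡M M∉Pd 1≤M (proj₁ g)
  tops : NewAtTops [] 0 x
  tops = NewAtTops-++⁺ P nP (old d∈Sᴾ d≤ℓ (NewAtTops-forget M∉R nR′))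
  floors : AboveFloor 0 0 x
  floors with m≤n⇒m<n∨m≡n d≤ℓ
  ... | inj₁ d<ℓ  = AboveFloor-++⁺ P fP (down d<ℓ dᴾ≤d fR′)
  ... | inj₂ refl = AboveFloor-++⁺ P fP (up ≤-refl (AboveFloor-refloor (All.map (≤-trans dᴾ≤d) d≤R) fR′))
  child≡ : ∀ P′ → P′ ≡ P → P′ ≢ [] → child (P′ ++ d ∷ R) (length P′) ≡ P ++ M ∷ d ∷ R
  child≡ []       _    P≢[] = ⊥-elim (P≢[] refl)
  child≡ (a ∷ P′) refl _
    rewrite child-split a P′ (d ∷ R) | proj₂ cayley
          | spanLast-none (_<? d) (All.dropWhile⁺ (_≟ d) (All.map ≤⇒≯ d≤R)) | takeWhile++dropWhile (_≟ d) R = refl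

All-head-++ : ∀ {P : ℕ → Set} xs {ys} → xs ≢ [] → All P xs → Maybe.All P (head (xs ++ ys))
All-head-++ []       xs≢[] _        = ⊥-elim (xs≢[] refl)
All-head-++ (x ∷ xs) _     (Px ∷ _) = just Px

-- Undoing an insertion that moved the plateau d ds: it returns to just after the last d of P₁ P₂.
module MoveBack (P₁ P₂ : List ℕ) (M d : ℕ) (ds Q : List ℕ) (g : Good ((P₁ ++ P₂) ++ M ∷ d ∷ ds ++ Q))
                (max≡M : maxL ((P₁ ++ P₂) ++ M ∷ d ∷ ds ++ Q) ≡ M) (M∉P : M ∉ P₁ ++ P₂) (d≢M : d ≢ M)
                (ℓ<d : lastOr 0 (P₁ ++ P₂) < d) (last₁ : LastSatisfies (_≡ d) P₁) (P₂≢d : All (∁ (_≡ d)) P₂)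
                (ds≡d : All (_≡ d) ds) (nsQ : Maybe.All (∁ (_≡ d)) (head Q)) where

  open Descent (P₁ ++ P₂) M d (ds ++ Q) g max≡M M∉P d≢M public

  x = P₁ ++ d ∷ ds ++ P₂ ++ Q
  P₁≢[] : P₁ ≢ []
  P₁≢[] refl = lookup P₂≢d d∈P refl
  ℓ₁≡d : lastOr 0 P₁ ≡ d
  ℓ₁≡d = LastSatisfies-lastOr 0 P₁ P₁≢[] last₁
  ℓ₂<d : lastOr d P₂ < d
  ℓ₂<d = subst (_< d) (trans (lastOr-++ 0 P₁ P₂) (cong (λ p → lastOr p P₂) ℓ₁≡d)) ℓ<d
  P₂≢[] : P₂ ≢ []
  P₂≢[] refl = <-irrefl refl ℓ₂<d
  d≤Q : All (d ≤_) Q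
  d≤Q = All.++⁻ʳ ds d≤R
  S₁ = reverseAcc [] P₁
  d∈S₁ : d ∈ S₁
  d∈S₁ = ∈-reverseAccʳ [] P₁ (subst (_∈ P₁) ℓ₁≡d (lastOr-∈ 0 P₁ P₁≢[]))
  n₁ : NewAtTops [] 0 P₁
  n₁ = proj₁ (NewAtTops-++⁻ P₁ nP)
  n₂ : NewAtTops S₁ d P₂
  n₂ = subst (λ p → NewAtTops S₁ p P₂) ℓ₁≡d (proj₂ (NewAtTops-++⁻ P₁ nP))
  same : SameOn Q (d ∷ Sᴾ) (reverseAcc (d ∷ S₁) P₂)
  same _ = to , from
    where
    to : ∀ {a} → a ∈ d ∷ Sᴾ → a ∈ reverseAcc (d ∷ S₁) P₂
    to (here refl) = ∈-reverseAccˡ (d ∷ S₁) P₂ (here refl)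
    to (there a∈) with ∈-++⁻ P₁ (∈-reverseAcc[] (P₁ ++ P₂) a∈)
    ... | inj₁ a∈P₁ = ∈-reverseAccˡ (d ∷ S₁) P₂ (there (∈-reverseAccʳ [] P₁ a∈P₁))
    ... | inj₂ a∈P₂ = ∈-reverseAccʳ (d ∷ S₁) P₂ a∈P₂
    from : ∀ {a} → a ∈ reverseAcc (d ∷ S₁) P₂ → a ∈ d ∷ Sᴾ
    from a∈ with ∈-reverseAcc⁻ (d ∷ S₁) P₂ a∈
    ... | inj₁ (here refl)  = here refl
    ... | inj₁ (there a∈S₁) = there (∈-reverseAccʳ [] (P₁ ++ P₂) (∈-++⁺ˡ (∈-reverseAcc[] P₁ a∈S₁)))
    ... | inj₂ a∈P₂         = there (∈-reverseAccʳ [] (P₁ ++ P₂) (∈-++⁺ʳ P₁ a∈P₂))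
  nQ : NewAtTops (reverseAcc (d ∷ S₁) P₂) (lastOr d P₂) Q
  nQ = NewAtTops-resp same (NewAtTops-reprev (head-above ≤-refl d≤Q nsQ) (head-above (<⇒≤ ℓ₂<d) d≤Q nsQ)
         (NewAtTops-forget (M∉R ∘ ∈-++⁺ʳ ds) (NewAtTops-plateau⁻ ds≡d (here refl) nR′)))
  tops : NewAtTops [] 0 x
  tops = NewAtTops-++⁺ P₁ n₁ (subst (λ p → NewAtTops S₁ p (d ∷ ds ++ P₂ ++ Q)) (sym ℓ₁≡d)
           (old d∈S₁ ≤-refl (NewAtTops-plateau⁺ ds≡d (here refl) (NewAtTops-++⁺ P₂ (NewAtTops-repeat d∈S₁ n₂) nQ))))
  f₁ : AboveFloor 0 0 P₁
  f₁ = proj₁ (AboveFloor-++⁻ P₁ fP)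
  D₁ = floorAfter 0 0 P₁
  f₂ : AboveFloor d D₁ P₂
  f₂ = subst (λ p → AboveFloor p D₁ P₂) ℓ₁≡d (proj₂ (AboveFloor-++⁻ P₁ fP))
  D₂≤d : floorAfter d D₁ P₂ ≤ d
  D₂≤d = <⇒≤ (≤-<-trans (floorAfter≤lastOr (subst (D₁ ≤_) ℓ₁≡d (floorAfter≤lastOr z≤n f₁)) f₂) ℓ₂<d)
  fQ : AboveFloor (lastOr d P₂) (floorAfter d D₁ P₂) Q
  fQ = AboveFloor-restart (Maybe.map <⇒≤ (head-above (<⇒≤ ℓ₂<d) d≤Q nsQ)) (All.map (≤-trans D₂≤d) d≤Q)
         (AboveFloor-plateau⁻ ds≡d fR′)
  floors : AboveFloor 0 0 x
  floors = AboveFloor-++⁺ P₁ f₁ (subst (λ p → AboveFloor p D₁ (d ∷ ds ++ P₂ ++ Q)) (sym ℓ₁≡d)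
             (up ≤-refl (AboveFloor-plateau⁺ ds≡d (AboveFloor-++⁺ P₂ f₂ fQ))))
  x↭ : x ↭ (P₁ ++ P₂) ++ d ∷ ds ++ Q
  x↭ = ↭-trans (++⁺ˡ P₁ (shifts (d ∷ ds) P₂)) (↭-reflexive (sym (++-assoc P₁ P₂ _)))
  cayley : Cayley x × newMax x ≡ M
  cayley = Cayley-↭-remove (↭-trans (↭-reflexive (++-assoc P₁ P₂ _)) (insert↭ P₁ P₂ (d ∷ ds) Q M))
             max≡M (M∉Pd ∘ ∈-resp-↭ x↭) 1≤M (proj₁ g)
  head≢d : Maybe.All (∁ (_≡ d)) (head (P₂ ++ Q))
  head≢d = All-head-++ P₂ P₂≢[] P₂≢d
  child≡ : ∀ P₁′ → P₁′ ≡ P₁ → P₁′ ≢ [] → child (P₁′ ++ d ∷ ds ++ P₂ ++ Q) (length P₁′) ≡ (P₁ ++ P₂) ++ M ∷ d ∷ ds ++ Q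
  child≡ []       _    P₁≢[]′ = ⊥-elim (P₁≢[]′ refl)
  child≡ (a ∷ P₁′) refl _
    rewrite child-split a P₁′ (d ∷ ds ++ P₂ ++ Q) | proj₂ cayley
          | takeWhile-++ (_≟ d) ds {P₂ ++ Q} ds≡d head≢d | dropWhile-++ (_≟ d) ds {P₂ ++ Q} ds≡d head≢d
          | spanLast-char (_<? d) P₂ {Q} (LastSatisfies-of d P₂ P₂≢[] ℓ₂<d) (All.map ≤⇒≯ d≤Q)
    = sym (++-assoc (a ∷ P₁′) P₂ _)

moveBack-IsParent : ∀ P₁ P₂ M d ds Q → Good ((P₁ ++ P₂) ++ M ∷ d ∷ ds ++ Q) → maxL ((P₁ ++ P₂) ++ M ∷ d ∷ ds ++ Q) ≡ M →
  M ∉ P₁ ++ P₂ → d ≢ M → lastOr 0 (P₁ ++ P₂) < d → LastSatisfies (_≡ d) P₁ → All (∁ (_≡ d)) P₂ →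
  All (_≡ d) ds → Maybe.All (∁ (_≡ d)) (head Q) →
  IsParent ((P₁ ++ P₂) ++ M ∷ d ∷ ds ++ Q) (P₁ ++ d ∷ ds ++ P₂ ++ Q) (length P₁)
moveBack-IsParent P₁ P₂ M d ds Q g max≡M M∉P d≢M ℓ<d last₁ P₂≢d ds≡d nsQ = record
  { good     = proj₁ cayley , tops , floors
  ; nonempty = ≢[] P₁
  ; mark     = marks-∈⁺ x (length P₁) (P₁ , d ∷ ds ++ P₂ ++ Q , refl , refl , P₁≢[] , ≤-reflexive (sym ℓ₁≡d))
  ; child≡   = child≡ P₁ refl P₁≢[]
  }
  where open MoveBack P₁ P₂ M d ds Q g max≡M M∉P d≢M ℓ<d last₁ P₂≢d ds≡d nsQ

removeMax-IsParent : ∀ P M R → Good (P ++ M ∷ R) → maxL (P ++ M ∷ R) ≡ M → M ∉ P → 2 ≤ length (P ++ M ∷ R) →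
                     IsParent (P ++ M ∷ R) (proj₁ (removeMax M P R)) (proj₂ (removeMax M P R))
removeMax-IsParent []      M [] g max≡M M∉P (s≤s ())
removeMax-IsParent (a ∷ P) M [] g max≡M M∉P _ = removeLast-IsParent (a ∷ P) M g max≡M M∉P (λ ())
removeMax-IsParent P M (d ∷ R) g max≡M M∉P _ with d ≟ M | d ≤? lastOr 0 P
... | yes refl | _       = removeDuplicate-IsParent P d R g max≡M M∉P
... | no d≢M   | yes d≤ℓ = removeKeep-IsParent P M d R g max≡M M∉P d≢M d≤ℓ
... | no d≢M   | no d≰ℓ
  with spanLast (_≟ d) P | spanLast-++ (_≟ d) P | spanLast-last (_≟ d) P | spanLast-rest (_≟ d) P
     | takeWhile (_≟ d) R | dropWhile (_≟ d) R | takeWhile++dropWhile (_≟ d) R | all-takeWhile (_≟ d) R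
     | all-head-dropWhile (_≟ d) R
...   | P₁ , P₂ | refl | last₁ | P₂≢d | ds | Q | refl | ds≡d | head≢d =
  moveBack-IsParent P₁ P₂ M d ds Q g max≡M M∉P d≢M (≰⇒> d≰ℓ) last₁ P₂≢d ds≡d head≢d

parent-IsParent : ∀ y → Good y → 2 ≤ length y → IsParent y (proj₁ (parent y)) (proj₂ (parent y))
parent-IsParent y g 2≤len with ∈⇒first (maxL∈ y (0<maxL y g y≢[]))
  where
  y≢[] : y ≢ []
  y≢[] refl = n≮0 2≤len
... | P , R , y≡ , M∉P = subst (λ z → IsParent z (proj₁ (parent z)) (proj₂ (parent z))) (sym y≡) of-split
  where
  M = maxL y
  max≡M : maxL (P ++ M ∷ R) ≡ M
  max≡M = cong maxL (sym y≡)
  of-split : IsParent (P ++ M ∷ R) (proj₁ (parent (P ++ M ∷ R))) (proj₂ (parent (P ++ M ∷ R)))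
  of-split rewrite parent-split P M R M∉P max≡M =
    removeMax-IsParent P M R (subst Good y≡ g) max≡M M∉P (subst (λ z → 2 ≤ length z) y≡ 2≤len)

-- Counting

count : ∀ {A : Set} → (A → Bool) → List A → ℕ
count p xs = length (filterᵇ p xs)

Unique-map-on : ∀ {A B : Set} (f : A → B) {xs} → (∀ {a b} → a ∈ xs → b ∈ xs → f a ≡ f b → a ≡ b) →
                Unique xs → Unique (map f xs)
Unique-map-on f inj []          = []
Unique-map-on f inj (a≢ ∷ uxs) =
  All.map⁺ (tabulate λ b∈ fa≡fb → lookup a≢ b∈ (inj (here refl) (there b∈) fa≡fb)) ∷
  Unique-map-on f (λ a∈ b∈ → inj (there a∈) (there b∈)) uxs

count-bijection : ∀ {A B : Set} (p : A → Bool) (q : B → Bool) (f : A → B) (g : B → A) {xs ys} →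
  Unique xs → Unique ys →
  (∀ {a} → a ∈ xs → T (p a) → f a ∈ ys × T (q (f a)) × g (f a) ≡ a) →
  (∀ {b} → b ∈ ys → T (q b) → g b ∈ xs × T (p (g b)) × f (g b) ≡ b) →
  count p xs ≡ count q ys
count-bijection p q f g {xs} {ys} uxs uys to from =
  trans (sym (length-map f xs′)) (↭-length (∼bag⇒↭ (unique∧set⇒bag (Unique-map-on f inj (Unique.filter⁺ _ uxs)) (Unique.filter⁺ _ uys) same)))
  where
  xs′ = filterᵇ p xs
  ys′ = filterᵇ q ys
  to′ : ∀ {a} → a ∈ xs′ → f a ∈ ys′ × g (f a) ≡ a
  to′ a∈ = let a∈xs , pa = ∈-filter⁻ _ a∈ ; fa∈ , qfa , gfa = to a∈xs pa in ∈-filter⁺ _ fa∈ qfa , gfa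
  inj : ∀ {a b} → a ∈ xs′ → b ∈ xs′ → f a ≡ f b → a ≡ b
  inj a∈ b∈ fa≡fb = trans (sym (proj₂ (to′ a∈))) (trans (cong g fa≡fb) (proj₂ (to′ b∈)))
  image⊆ : ∀ {b} → b ∈ map f xs′ → b ∈ ys′
  image⊆ b∈ with ∈-map⁻ f b∈
  ... | _ , a∈ , refl = proj₁ (to′ a∈)
  ⊆image : ∀ {b} → b ∈ ys′ → b ∈ map f xs′
  ⊆image b∈ = let b∈ys , qb = ∈-filter⁻ _ b∈ ; gb∈ , pgb , fgb = from b∈ys qb in
              subst (_∈ map f xs′) fgb (∈-map⁺ f (∈-filter⁺ _ gb∈ pgb))
  same : map f xs′ ∼[ set ] ys′
  same = mk⇔ image⊆ ⊆image

∈-range1⇔ : ∀ {v} m → v ∈ range1 m ⇔ (1 ≤ v × v ≤ m)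
∈-range1⇔ m = mk⇔ to from
  where
  to : ∀ {v} → v ∈ range1 m → 1 ≤ v × v ≤ m
  to v∈ with ∈-applyUpTo⁻ suc v∈
  ... | i , i<m , refl = s≤s z≤n , i<m
  from : ∀ {v} → 1 ≤ v × v ≤ m → v ∈ range1 m
  from (s≤s _ , v≤m) = ∈-applyUpTo⁺ suc v≤m

InRange : ℕ → ℕ → Set
InRange m v = 1 ≤ v × v ≤ m

∈-words⇔ : ∀ n m {y} → y ∈ words n m ⇔ (length y ≡ n × All (InRange m) y)
∈-words⇔ n m = mk⇔ (to n) (from n)
  where
  to : ∀ n {y} → y ∈ words n m → length y ≡ n × All (InRange m) y
  to zero    (here refl) = refl , []
  to (suc n) y∈ with find (∈-concatMap⁻ (λ v → map (v ∷_) (words n m)) {xs = range1 m} y∈)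
  ... | v , v∈ , y∈′ with ∈-map⁻ (v ∷_) y∈′
  ...   | y′ , y′∈ , refl = let len , inRange = to n y′∈ in cong suc len , Equivalence.to (∈-range1⇔ m) v∈ ∷ inRange
  from : ∀ n {y} → length y ≡ n × All (InRange m) y → y ∈ words n m
  from zero    {[]}    _                       = here refl
  from (suc n) {v ∷ y} (len , v∈m ∷ inRange) =
    ∈-concatMap⁺ (λ v → map (v ∷_) (words n m))
      (Any.map (λ { refl → ∈-map⁺ (v ∷_) (from n (suc-injective len , inRange)) }) (Equivalence.from (∈-range1⇔ m) v∈m))

concatMap≡cartesianProductWith : ∀ {A B C : Set} (f : A → B → C) xs ys →
                                 concatMap (λ x → map (f x) ys) xs ≡ cartesianProductWith f xs ys
concatMap≡cartesianProductWith f []       ys = refl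
concatMap≡cartesianProductWith f (x ∷ xs) ys = cong (map (f x) ys ++_) (concatMap≡cartesianProductWith f xs ys)

Unique-words : ∀ n m → Unique (words n m)
Unique-words zero    m = [] ∷ []
Unique-words (suc n) m = subst Unique (sym (concatMap≡cartesianProductWith _∷_ (range1 m) (words n m)))
  (Unique.cartesianProductWith⁺ _∷_ ∷-injective
    (Unique.applyUpTo⁺₁ suc m (λ i<j _ eq → <⇒≢ i<j (suc-injective eq))) (Unique-words n m))

Unique-concatMap-, : ∀ {A B : Set} (W : A → List B) {L} → Unique L → (∀ a → Unique (W a)) →
                     Unique (concatMap (λ a → map (a ,_) (W a)) L)
Unique-concatMap-, W []                  uW = []
Unique-concatMap-, W {a ∷ L} (a≢L ∷ uL) uW =
  Unique.++⁺ (Unique.map⁺ (proj₂ ∘ ,-injective) (uW a)) (Unique-concatMap-, W uL uW) disjoint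
  where
  disjoint : ∀ {q} → ¬ (q ∈ map (a ,_) (W a) × q ∈ concatMap (λ a → map (a ,_) (W a)) L)
  disjoint (q∈₁ , q∈₂) with ∈-map⁻ (a ,_) q∈₁ | find (∈-concatMap⁻ (λ a → map (a ,_) (W a)) {xs = L} q∈₂)
  ... | _ , _ , refl | a′ , a′∈L , q∈ with ∈-map⁻ (a′ ,_) q∈
  ...   | _ , _ , eq = lookup a≢L a′∈L (proj₁ (,-injective eq))

marksFrom-≥ : ∀ {k} i q w → k ∈ marksFrom i q w → i ≤ k
marksFrom-≥ i q []      (here refl) = ≤-refl
marksFrom-≥ i q (v ∷ w) k∈ with v ≤? q
marksFrom-≥ i q (v ∷ w) (here refl) | yes _ = ≤-refl
marksFrom-≥ i q (v ∷ w) (there k∈)  | yes _ = <⇒≤ (marksFrom-≥ (suc i) v w k∈)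
marksFrom-≥ i q (v ∷ w) k∈          | no  _ = <⇒≤ (marksFrom-≥ (suc i) v w k∈)

Unique-marksFrom : ∀ i q w → Unique (marksFrom i q w)
Unique-marksFrom i q []      = [] ∷ []
Unique-marksFrom i q (v ∷ w) with v ≤? q
... | yes _ = tabulate (λ k∈ → <⇒≢ (marksFrom-≥ (suc i) v w k∈)) ∷ Unique-marksFrom (suc i) v w
... | no  _ = Unique-marksFrom (suc i) v w

Unique-marks : ∀ x → Unique (marks x)
Unique-marks []      = []
Unique-marks (a ∷ w) = tabulate (λ k∈ → <⇒≢ (marksFrom-≥ 1 a w k∈)) ∷ Unique-marksFrom 1 a w

-- Each letter of w is an ascent top or follows a mark, and the end is a mark.
length-marksFrom : ∀ i q w → length (marksFrom i q w) + ascentsAfter q w ≡ suc (length w)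
length-marksFrom i q []      = refl
length-marksFrom i q (v ∷ w) with v ≤? q
... | yes v≤q rewrite <ᵇ-false v≤q = cong suc (length-marksFrom (suc i) v w)
... | no  v≰q rewrite <ᵇ-true (≰⇒> v≰q) = trans (+-suc _ _) (cong suc (length-marksFrom (suc i) v w))

-- The parent of y is one letter shorter, and y adds at most the parent's newMax to its letters.
≤length-step : ∀ n y → (∀ x → Good x → length x ≡ suc n → All (_≤ suc n) x) → Good y → length y ≡ 2 + n → All (_≤ 2 + n) y
≤length-step n y ih g len = tabulate bound
  where
  P = parent-IsParent y g (subst (2 ≤_) (sym len) (s≤s (s≤s z≤n)))
  x = proj₁ (parent y)
  C = child-IsChild x (proj₂ (parent y)) (IsParent.good P) (IsParent.nonempty P) (IsParent.mark P)
  x≤ : All (_≤ suc n) x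
  x≤ = ih x (IsParent.good P) (suc-injective (trans (sym (IsChild.length≡ C)) (trans (cong length (IsParent.child≡ P)) len)))
  bound : ∀ {u} → u ∈ y → u ≤ 2 + n
  bound u∈y with IsChild.letters C (subst (_ ∈_) (sym (IsParent.child≡ P)) u∈y)
  ... | inj₁ u∈x  = m≤n⇒m≤1+n (lookup x≤ u∈x)
  ... | inj₂ refl = s≤s (maxL≤ x x≤)

Good⇒≤length : ∀ n x → Good x → length x ≡ n → All (_≤ n) x
Good⇒≤length zero          []       _                        _   = []
Good⇒≤length (suc zero)    (v ∷ []) ((1≤v ∷ [] , onto) , _) _
  with onto (subst (0 <_) (sym (⊔-identityʳ v)) 1≤v)
... | here 1≡v = ≤-reflexive (sym 1≡v) ∷ []
Good⇒≤length (suc (suc n)) y        g                        len = ≤length-step n y (Good⇒≤length (suc n)) g len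

isGood : List ℕ → Bool
isGood x = isModAscent x ∧ avoids x pattern2321

markedWords : ℕ → List (List ℕ × ℕ)
markedWords n = concatMap (λ x → map (x ,_) (marks x)) (words n n)

∈-markedWords⁻ : ∀ {n x m} → (x , m) ∈ markedWords n → x ∈ words n n × m ∈ marks x
∈-markedWords⁻ {n} q∈ with find (∈-concatMap⁻ (λ x → map (x ,_) (marks x)) {xs = words n n} q∈)
... | x , x∈ , q∈′ with ∈-map⁻ (x ,_) q∈′
...   | m , m∈ , refl = x∈ , m∈

∈-markedWords⁺ : ∀ {n x m} → x ∈ words n n → m ∈ marks x → (x , m) ∈ markedWords n
∈-markedWords⁺ x∈ m∈ = ∈-concatMap⁺ (λ x → map (x ,_) (marks x)) (Any.map (λ { refl → ∈-map⁺ (_ ,_) m∈ }) x∈)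

∈-words⇒≢[] : ∀ n m {x} → x ∈ words (suc n) m → x ≢ []
∈-words⇒≢[] n m x∈ refl = 0≢1+n (proj₁ (Equivalence.to (∈-words⇔ (suc n) m) x∈))

child-∈-words : ∀ n x m → Good x → x ∈ words (suc n) (suc n) → m ∈ marks x → child x m ∈ words (2 + n) (2 + n)
child-∈-words n x m g x∈ m∈ =
  Equivalence.from (∈-words⇔ (2 + n) (2 + n)) (trans (IsChild.length≡ C) (cong suc len) , tabulate (inRange ∘ IsChild.letters C))
  where
  C : IsChild x m (child x m)
  C = child-IsChild x m g (∈-words⇒≢[] n (suc n) x∈) m∈
  len : length x ≡ suc n
  len = proj₁ (Equivalence.to (∈-words⇔ (suc n) (suc n)) x∈)
  x-inRange : All (InRange (suc n)) x
  x-inRange = proj₂ (Equivalence.to (∈-words⇔ (suc n) (suc n)) x∈)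
  inRange : ∀ {u} → u ∈ x ⊎ u ≡ newMax x → InRange (2 + n) u
  inRange (inj₁ u∈x)  = let 1≤u , u≤ = lookup x-inRange u∈x in 1≤u , m≤n⇒m≤1+n u≤
  inRange (inj₂ refl) = s≤s z≤n , s≤s (maxL≤ x (All.map proj₂ x-inRange))

parent-∈-words : ∀ n y → Good y → y ∈ words (2 + n) (2 + n) → proj₁ (parent y) ∈ words (suc n) (suc n)
parent-∈-words n y g y∈ = Equivalence.from (∈-words⇔ (suc n) (suc n))
  (lenx , tabulate (λ u∈ → lookup (proj₁ (proj₁ gx)) u∈ , lookup (Good⇒≤length (suc n) x gx lenx) u∈))
  where
  len : length y ≡ 2 + n
  len = proj₁ (Equivalence.to (∈-words⇔ (2 + n) (2 + n)) y∈)
  P : IsParent y (proj₁ (parent y)) (proj₂ (parent y))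
  P = parent-IsParent y g (subst (2 ≤_) (sym len) (s≤s (s≤s z≤n)))
  x = proj₁ (parent y)
  gx : Good x
  gx = IsParent.good P
  C : IsChild x (proj₂ (parent y)) (child x (proj₂ (parent y)))
  C = child-IsChild x (proj₂ (parent y)) gx (IsParent.nonempty P) (IsParent.mark P)
  lenx : length x ≡ suc n
  lenx = suc-injective (trans (sym (IsChild.length≡ C)) (trans (cong length (IsParent.child≡ P)) len))

count-via-children : ∀ n h → count (λ y → isGood y ∧ (ascents y ≡ᵇ h)) (words (2 + n) (2 + n))
                           ≡ count (λ (x , m) → isGood x ∧ (ascents (child x m) ≡ᵇ h)) (markedWords (suc n))
count-via-children n h = sym (count-bijection _ _ (λ (x , m) → child x m) parent
  (Unique-concatMap-, marks (Unique-words (suc n) (suc n)) Unique-marks) (Unique-words (2 + n) (2 + n)) to from)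
  where
  to : ∀ {q} → q ∈ markedWords (suc n) → T (isGood (proj₁ q) ∧ (ascents (child (proj₁ q) (proj₂ q)) ≡ᵇ h)) →
       child (proj₁ q) (proj₂ q) ∈ words (2 + n) (2 + n) × T (isGood (child (proj₁ q) (proj₂ q)) ∧ (ascents (child (proj₁ q) (proj₂ q)) ≡ᵇ h))
       × parent (child (proj₁ q) (proj₂ q)) ≡ q
  to {x , m} q∈ t =
    let x∈ , m∈ = ∈-markedWords⁻ {suc n} q∈
        good , asc≡h = Equivalence.to T-∧ t
        g = Equivalence.to (good⇔ x) good
        C = child-IsChild x m g (∈-words⇒≢[] n (suc n) x∈) m∈
    in child-∈-words n x m g x∈ m∈ , Equivalence.from T-∧ (Equivalence.from (good⇔ _) (IsChild.good C) , asc≡h) , IsChild.parent≡ C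
  from : ∀ {y} → y ∈ words (2 + n) (2 + n) → T (isGood y ∧ (ascents y ≡ᵇ h)) →
         parent y ∈ markedWords (suc n) × T (isGood (proj₁ (parent y)) ∧ (ascents (child (proj₁ (parent y)) (proj₂ (parent y))) ≡ᵇ h))
         × child (proj₁ (parent y)) (proj₂ (parent y)) ≡ y
  from {y} y∈ t =
    let good , asc≡h = Equivalence.to T-∧ t
        g = Equivalence.to (good⇔ y) good
        P = parent-IsParent y g (subst (2 ≤_) (sym (proj₁ (Equivalence.to (∈-words⇔ (2 + n) (2 + n)) y∈))) (s≤s (s≤s z≤n)))
    in ∈-markedWords⁺ {suc n} (parent-∈-words n y g y∈) (IsParent.mark P) ,
       Equivalence.from T-∧ (Equivalence.from (good⇔ _) (IsParent.good P) , subst (λ z → T (ascents z ≡ᵇ h)) (sym (IsParent.child≡ P)) asc≡h) ,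
       IsParent.child≡ P

count-∷ : ∀ {A : Set} (p : A → Bool) x xs → count p (x ∷ xs) ≡ indicator (p x) + count p xs
count-∷ p x xs with p x
... | true  = refl
... | false = refl

count≡sum : ∀ {A : Set} (p : A → Bool) xs → count p xs ≡ sum (map (indicator ∘ p) xs)
count≡sum p []       = refl
count≡sum p (x ∷ xs) = trans (count-∷ p x xs) (cong (indicator (p x) +_) (count≡sum p xs))

count-filterᵇ : ∀ {A : Set} (p q : A → Bool) xs → length (filterᵇ q (filterᵇ p xs)) ≡ count (λ x → p x ∧ q x) xs
count-filterᵇ p q []       = refl
count-filterᵇ p q (x ∷ xs) with p x
... | false = count-filterᵇ p q xs
... | true with q x
...   | true  = cong suc (count-filterᵇ p q xs)
...   | false = count-filterᵇ p q xs

sum-map-cong : ∀ {A : Set} {f g : A → ℕ} xs → (∀ {x} → x ∈ xs → f x ≡ g x) → sum (map f xs) ≡ sum (map g xs)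
sum-map-cong []       _   = refl
sum-map-cong (x ∷ xs) f≗g = cong₂ _+_ (f≗g (here refl)) (sum-map-cong xs (f≗g ∘ there))

sum-map-+ : ∀ {A : Set} (f g : A → ℕ) xs → sum (map (λ x → f x + g x) xs) ≡ sum (map f xs) + sum (map g xs)
sum-map-+ f g []       = refl
sum-map-+ f g (x ∷ xs) rewrite sum-map-+ f g xs = interchange +-commutativeSemigroup (f x) (g x) _ _

sum-map-* : ∀ {A : Set} c (f : A → ℕ) xs → sum (map (λ x → c * f x) xs) ≡ c * sum (map f xs)
sum-map-* c f []       = sym (*-zeroʳ c)
sum-map-* c f (x ∷ xs) rewrite sum-map-* c f xs = sym (*-distribˡ-+ c (f x) _)

count-cong : ∀ {A : Set} {p q : A → Bool} xs → (∀ {x} → x ∈ xs → p x ≡ q x) → count p xs ≡ count q xs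
count-cong {p = p} {q} xs p≗q = trans (count≡sum p xs) (trans (sum-map-cong xs (cong indicator ∘ p≗q)) (sym (count≡sum q xs)))

count-++ : ∀ {A : Set} (p : A → Bool) xs ys → count p (xs ++ ys) ≡ count p xs + count p ys
count-++ p xs ys = trans (cong length (filter-++ _ xs ys)) (length-++ (filterᵇ p xs))

count-map-, : ∀ {A B : Set} (p : A × B → Bool) a ys → count p (map (a ,_) ys) ≡ count (λ b → p (a , b)) ys
count-map-, p a []       = refl
count-map-, p a (b ∷ ys) = trans (count-∷ p _ _) (trans (cong (_ +_) (count-map-, p a ys)) (sym (count-∷ _ b ys)))

count-concatMap-, : ∀ {A B : Set} (p : A × B → Bool) (W : A → List B) L →
                    count p (concatMap (λ a → map (a ,_) (W a)) L) ≡ sum (map (λ a → count (λ b → p (a , b)) (W a)) L)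
count-concatMap-, p W []      = refl
count-concatMap-, p W (a ∷ L) =
  trans (count-++ p (map (a ,_) (W a)) _) (cong₂ _+_ (count-map-, p a (W a)) (count-concatMap-, p W L))

count-const : ∀ {A : Set} (p : A → Bool) b xs → (∀ {x} → x ∈ xs → p x ≡ b) → count p xs ≡ indicator b * length xs
count-const p b []       _   = sym (*-zeroʳ (indicator b))
count-const p b (x ∷ xs) p≡b = begin
  count p (x ∷ xs)                         ≡⟨ count-∷ p x xs ⟩
  indicator (p x) + count p xs             ≡⟨ cong₂ _+_ (cong indicator (p≡b (here refl))) (count-const p b xs (p≡b ∘ there)) ⟩
  indicator b + indicator b * length xs    ≡⟨ sym (*-suc (indicator b) (length xs)) ⟩
  indicator b * length (x ∷ xs)            ∎
  where open ≡-Reasoning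

ascents-child : ∀ x m → Good x → x ≢ [] → m ∈ marks x → ascents (child x m) ≡ gain m + ascents x
ascents-child x m g x≢[] m∈ = suc-injective (begin
  suc (ascents (child x m))        ≡⟨ sym (ascentsAfter0 (child x m) (IsChild.good C) child≢[]) ⟩
  ascentsAfter 0 (child x m)       ≡⟨ IsChild.ascents≡ C ⟩
  gain m + ascentsAfter 0 x        ≡⟨ cong (gain m +_) (ascentsAfter0 x g x≢[]) ⟩
  gain m + suc (ascents x)         ≡⟨ +-suc (gain m) (ascents x) ⟩
  suc (gain m + ascents x)         ∎)
  where
  open ≡-Reasoning
  C = child-IsChild x m g x≢[] m∈
  child≢[] : child x m ≢ []
  child≢[] eq with trans (sym (cong length eq)) (IsChild.length≡ C)
  ... | ()

-- The N ∸ h children at positive marks of a word with h ascents have h + 1 ascents.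
growthTerm : ℕ → ℕ → List ℕ → ℕ
growthTerm N zero    x = 0
growthTerm N (suc k) x = (N ∸ k) * indicator (isGood x ∧ (ascents x ≡ᵇ k))

indicator-≡ᵇ-* : ∀ a k N → indicator (a ≡ᵇ k) * (N ∸ a) ≡ (N ∸ k) * indicator (a ≡ᵇ k)
indicator-≡ᵇ-* a k N with a ≡ᵇ k | ≡ᵇ-reflects-≡ a k
... | true  | ofʸ refl = trans (+-identityʳ (N ∸ a)) (sym (*-identityʳ (N ∸ a)))
... | false | ofⁿ _    = sym (*-zeroʳ (N ∸ k))

count-children-good : ∀ N h a w → let x = a ∷ w in Good x → length x ≡ N →
  count (λ m → ascents (child x m) ≡ᵇ h) (marks x) ≡ indicator (ascents x ≡ᵇ h) + indicator (suc (ascents x) ≡ᵇ h) * (N ∸ ascents x)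
count-children-good N h a w g len = begin
  count P (0 ∷ marksFrom 1 a w)                  ≡⟨ count-∷ P 0 (marksFrom 1 a w) ⟩
  indicator (P 0) + count P (marksFrom 1 a w)    ≡⟨ cong₂ _+_ (cong (λ k → indicator (k ≡ᵇ h)) (ascents-child x 0 g (λ ()) (here refl)))
                                                              (count-const P (suc (ascents x) ≡ᵇ h) _ at-positive) ⟩
  indicator (ascents x ≡ᵇ h) + indicator (suc (ascents x) ≡ᵇ h) * length (marksFrom 1 a w)
                                                 ≡⟨ cong (λ k → indicator (ascents x ≡ᵇ h) + indicator (suc (ascents x) ≡ᵇ h) * k) length≡ ⟩
  indicator (ascents x ≡ᵇ h) + indicator (suc (ascents x) ≡ᵇ h) * (N ∸ ascents x) ∎
  where
  open ≡-Reasoning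
  x = a ∷ w
  P = λ m → ascents (child x m) ≡ᵇ h
  at-positive : ∀ {m} → m ∈ marksFrom 1 a w → P m ≡ (suc (ascents x) ≡ᵇ h)
  at-positive {m} m∈ with marksFrom-≥ 1 a w m∈
  at-positive {suc m} m∈ | _ = cong (_≡ᵇ h) (ascents-child x (suc m) g (λ ()) (there m∈))
  length≡ : length (marksFrom 1 a w) ≡ N ∸ ascents x
  length≡ = trans (sym (m+n∸n≡m (length (marksFrom 1 a w)) (ascentsAfter a w)))
                  (cong₂ _∸_ (trans (length-marksFrom 1 a w) len) (sym (ascents≡ascentsAfter a w)))

count-children : ∀ N h x → length x ≡ N → x ≢ [] →
  count (λ m → isGood x ∧ (ascents (child x m) ≡ᵇ h)) (marks x) ≡ indicator (isGood x ∧ (ascents x ≡ᵇ h)) + growthTerm N h x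
count-children N h       []      _   x≢[] = ⊥-elim (x≢[] refl)
count-children N zero    (a ∷ w) len _ with isGood (a ∷ w) in good
... | false = count-const _ false (marks (a ∷ w)) (λ _ → refl)
... | true  = count-children-good N 0 a w (Equivalence.to (good⇔ _) (subst T (sym good) tt)) len
count-children N (suc k) (a ∷ w) len _ with isGood (a ∷ w) in good
... | false = trans (count-const _ false (marks (a ∷ w)) (λ _ → refl)) (sym (*-zeroʳ (N ∸ k)))
... | true  = trans (count-children-good N (suc k) a w (Equivalence.to (good⇔ _) (subst T (sym good) tt)) len)
                    (cong (indicator (ascents (a ∷ w) ≡ᵇ suc k) +_) (indicator-≡ᵇ-* (ascents (a ∷ w)) k N))

-- The recurrence

goodCount : ℕ → ℕ → ℕ
goodCount n h = count (λ y → isGood y ∧ (ascents y ≡ᵇ h)) (words n n)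

growth : (ℕ → ℕ) → ℕ → ℕ → ℕ
growth c N zero    = 0
growth c N (suc k) = (N ∸ k) * c k

goodCount-rec : ∀ n h → goodCount (2 + n) h ≡ goodCount (suc n) h + growth (goodCount (suc n)) (suc n) h
goodCount-rec n h = begin
  goodCount (2 + n) h                                                   ≡⟨ count-via-children n h ⟩
  count P (markedWords (suc n))                                         ≡⟨ count-concatMap-, P marks W ⟩
  sum (map (λ x → count (λ m → P (x , m)) (marks x)) W)                 ≡⟨ sum-map-cong W per-word ⟩
  sum (map (λ x → indicator (Q h x) + growthTerm (suc n) h x) W)        ≡⟨ sum-map-+ (indicator ∘ Q h) (growthTerm (suc n) h) W ⟩
  sum (map (indicator ∘ Q h) W) + sum (map (growthTerm (suc n) h) W)    ≡⟨ cong₂ _+_ (sym (count≡sum (Q h) W)) (sum-growthTerm h) ⟩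
  goodCount (suc n) h + growth (goodCount (suc n)) (suc n) h            ∎
  where
  open ≡-Reasoning
  W = words (suc n) (suc n)
  P = λ ((x , m) : List ℕ × ℕ) → isGood x ∧ (ascents (child x m) ≡ᵇ h)
  Q = λ k x → isGood x ∧ (ascents x ≡ᵇ k)
  per-word : ∀ {x} → x ∈ W → count (λ m → P (x , m)) (marks x) ≡ indicator (Q h x) + growthTerm (suc n) h x
  per-word x∈ = count-children (suc n) h _ (proj₁ (Equivalence.to (∈-words⇔ (suc n) (suc n)) x∈)) (∈-words⇒≢[] n (suc n) x∈)
  sum-growthTerm : ∀ h → sum (map (growthTerm (suc n) h) W) ≡ growth (goodCount (suc n)) (suc n) h
  sum-growthTerm zero    = sum-map-* 0 (λ _ → 0) W
  sum-growthTerm (suc k) = trans (sum-map-* (suc n ∸ k) (indicator ∘ Q k) W) (cong ((suc n ∸ k) *_) (sym (count≡sum (Q k) W)))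

S-vanishes : ∀ n k → n < k → S n k ≡ 0
S-vanishes zero    (suc k) _         = refl
S-vanishes (suc n) (suc k) (s≤s n<k) rewrite S-vanishes n (suc k) (m≤n⇒m≤1+n n<k) | S-vanishes n k n<k = trans (+-identityʳ (suc k * 0)) (*-zeroʳ (suc k))

stirling-rec : ∀ n h → S (2 + n) (2 + n ∸ h) ≡ S (suc n) (suc n ∸ h) + growth (λ k → S (suc n) (suc n ∸ k)) (suc n) h
stirling-rec n zero    rewrite S-vanishes (suc n) (2 + n) ≤-refl | *-zeroʳ (2 + n) = sym (+-identityʳ _)
stirling-rec n (suc k) with k ≤? n
... | yes k≤n rewrite +-∸-assoc 1 k≤n = +-comm _ (S (suc n) (n ∸ k))
... | no  k≰n rewrite m≤n⇒m∸n≡0 (≰⇒> k≰n) | m≤n⇒m∸n≡0 (<⇒≤ (≰⇒> k≰n)) = refl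

growth-cong : ∀ {c c′} N h → (∀ k → c k ≡ c′ k) → growth c N h ≡ growth c′ N h
growth-cong N zero    _    = refl
growth-cong N (suc k) c≗c′ = cong ((N ∸ k) *_) (c≗c′ k)

goodCount≡S : ∀ n h → goodCount (suc n) h ≡ S (suc n) (suc n ∸ h)
goodCount≡S zero    zero    = refl
goodCount≡S zero    (suc k) rewrite 0∸n≡0 k = refl
goodCount≡S (suc n) h       = begin
  goodCount (2 + n) h                                                           ≡⟨ goodCount-rec n h ⟩
  goodCount (suc n) h + growth (goodCount (suc n)) (suc n) h                    ≡⟨ cong₂ _+_ (goodCount≡S n h) (growth-cong (suc n) h (goodCount≡S n)) ⟩
  S (suc n) (suc n ∸ h) + growth (λ k → S (suc n) (suc n ∸ k)) (suc n) h        ≡⟨ sym (stirling-rec n h) ⟩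
  S (2 + n) (2 + n ∸ h)                                                         ∎
  where open ≡-Reasoning

countMAS≡goodCount : ∀ n h → countMAS n h ≡ goodCount n h
countMAS≡goodCount n h = trans (count-filterᵇ isModAscent _ (words n n))
                               (count-cong (words n n) (λ {x} _ → sym (∧-assoc (isModAscent x) _ _)))

mainTheorem2 : (n h : ℕ) → 1 ≤ n → h ≤ n ∸ 1 → countMAS n h ≡ S n (n ∸ h)
mainTheorem2 (suc n) h _ _ = trans (countMAS≡goodCount (suc n) h) (goodCount≡S n h)
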